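{- Let $p$ be a border strip, and $S(p)$ the corresponding border strip matroid, with ground set $[n]$. Then the normalized volume of the border strip matroid polytope $\mathcal{P}(S(p))$ equals $f_{S(p)}$, the number of standard Young tableaux of shape $S(p)$.
   Context: Lattice paths use steps $E=(1,0)$, $N=(0,1)$. For lattice paths $P,Q$ from $(0,0)$ to $(m,r)$ with $P$ never above $Q$, $\mathcal{M}[P,Q]$ is the matroid on $[m+r]$ whose bases are the $r$-subsets $B$ such that the lattice path with North steps exactly at the positions in $B$ stays in the region bounded by $P$ and $Q$; $\mathcal{P}(\mathcal{M})=\mathrm{conv}\{\sum_{i\in B}e_i : B\text{ a basis}\}$. A border strip $p$ is a sequence of $m+r-1$ unit boxes from the box with lower-left corner $(0,0)$ to the box with upper-right corner $(m,r)$, each box immediately right of or immediately above the previous one; $S(p)=\mathcal{M}[P,Q]$ for the paths $P,Q$ whose region is exactly $p$, and $n=m+r$. A standard Young tableau of shape $S(p)$ is a bijective filling of the boxes of $p$ with $1,\dots,m+r-1$ which increases from left to right along rows and decreases from bottom to top along columns. Normalized volume: $\mathcal{P}(S(p))$ lies in the hyperplane $x_1+\dots+x_n=r$; project it to $\mathbb{R}^{n-1}$ by forgetting the last coordinate and take $(n-1)!$ times the Euclidean volume (so a unit simplex has volume $1$). -}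

module Defs where

open import Data.Nat using (ℕ; zero; suc; _!; _+_; _*_; _^_; _≤_; _<_; NonZero)
open import Data.Nat.Properties using (m^n≢0)

open import Data.Bool using (Bool; true; false; if_then_else_)
open import Data.List using (List; []; _∷_; _++_; map; take; length; foldr)
open import Data.List.Relation.Unary.All using (All)
open import Data.List.Relation.Unary.Unique.Propositional using (Unique)
open import Data.List.Membership.Propositional using (_∈_)
open import Data.Vec using (Vec; []; _∷_; lookup; toList)
import Data.Vec as V
open import Data.Fin using (Fin; inject₁)
import Data.Fin as F
open import Data.Product using (Σ; ∃; _×_; _,_; proj₁; proj₂)
open import Data.Integer using (ℤ; +_)
open import Data.Rational using (ℚ; 0ℚ; 1ℚ; _/_; ∣_∣; _-_) renaming (_+_ to _+ℚ_; _*_ to _*ℚ_; _≤_ to _≤ℚ_; _<_ to _<ℚ_)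
open import Relation.Binary.PropositionalEquality using (_≡_)

-- A border strip is encoded by the list of moves between consecutive
-- boxes: R = next box immediately to the right, U = next box immediately
-- above.  The first box has lower-left corner (0,0); the strip has
-- suc (length p) = m + r - 1 boxes, with m = 1 + #R and r = 1 + #U.

data Step : Set where
  R U : Step

BorderStrip : Set
BorderStrip = List Step

countR : BorderStrip → ℕ
countR []      = 0
countR (R ∷ s) = suc (countR s)
countR (U ∷ s) = countR s

countU : BorderStrip → ℕ
countU []      = 0
countU (R ∷ s) = countU s
countU (U ∷ s) = suc (countU s)

mOf : BorderStrip → ℕ
mOf p = suc (countR p)

rOf : BorderStrip → ℕ
rOf p = suc (countU p)

-- n - 1  (dimension after forgetting the last coordinate)
dOf : BorderStrip → ℕ
dOf p = countR p + suc (countU p)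

-- n = m + r  (definitionally equal to suc (dOf p))
nOf : BorderStrip → ℕ
nOf p = mOf p + rOf p

boxesFrom : (s : List Step) → ℕ → ℕ → Vec (ℕ × ℕ) (suc (length s))
boxesFrom []      x y = (x , y) ∷ []
boxesFrom (R ∷ s) x y = (x , y) ∷ boxesFrom s (suc x) y
boxesFrom (U ∷ s) x y = (x , y) ∷ boxesFrom s x (suc y)

nBoxes : BorderStrip → ℕ
nBoxes p = suc (length p)

box : (p : BorderStrip) → Fin (nBoxes p) → ℕ × ℕ
box p i = lookup (boxesFrom p 0 0) i

-- Lattice paths as step lists: true = N = (0,1), false = E = (1,0).

isU : Step → Bool
isU R = false
isU U = true

-- The two boundary paths of the region p:
-- Q (upper-left boundary) and P (lower-right boundary).
upperPath : BorderStrip → List Bool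
upperPath p = true ∷ (map isU p ++ (false ∷ []))

lowerPath : BorderStrip → List Bool
lowerPath p = false ∷ (map isU p ++ (true ∷ []))

countTrue : List Bool → ℕ
countTrue []           = 0
countTrue (true ∷ bs)  = suc (countTrue bs)
countTrue (false ∷ bs) = countTrue bs

height : List Bool → ℕ → ℕ
height bs k = countTrue (take k bs)

-- B ⊆ [n] given by its characteristic vector; the associated lattice path
-- has a North step exactly at the positions in B.  It stays in the region
-- between P and Q iff after every k steps its point lies weakly above P
-- and weakly below Q (points after k steps all lie on x + y = k).
IsBasis : (p : BorderStrip) → Vec Bool (nOf p) → Set
IsBasis p B =
  (countTrue (toList B) ≡ rOf p) ×
  (∀ k → k ≤ nOf p →
     (height (lowerPath p) k ≤ height (toList B) k) ×
     (height (toList B) k ≤ height (upperPath p) k))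

ConvComb : BorderStrip → Set
ConvComb p = List (Vec Bool (nOf p) × ℚ)

sumℚ : List ℚ → ℚ
sumℚ = foldr _+ℚ_ 0ℚ

ValidComb : (p : BorderStrip) → ConvComb p → Set
ValidComb p L =
  All (λ bw → IsBasis p (proj₁ bw) × (0ℚ ≤ℚ proj₂ bw)) L ×
  (sumℚ (map proj₂ L) ≡ 1ℚ)

combCoord : (p : BorderStrip) → ConvComb p → Fin (nOf p) → ℚ
combCoord p L i = sumℚ (map (λ bw → if lookup (proj₁ bw) i then proj₂ bw else 0ℚ) L)

InPolytope : (p : BorderStrip) → Vec ℚ (nOf p) → Set
InPolytope p x =
  Σ (ConvComb p) λ L → ValidComb p L × (∀ i → combCoord p L i ≡ lookup x i)

InProjection : (p : BorderStrip) → Vec ℚ (dOf p) → Set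
InProjection p y =
  Σ (Vec ℚ (nOf p)) λ x → InPolytope p x × (∀ i → lookup x (inject₁ i) ≡ lookup y i)

GridPoint : (p : BorderStrip) → ℕ → Vec ℤ (dOf p) → Set
GridPoint p t z = InProjection p (V.map (λ zi → zi / suc t) z)

IsCount : {A : Set} → (A → Set) → ℕ → Set
IsCount {A} P k =
  Σ (List A) λ xs → Unique xs × (length xs ≡ k) ×
    (∀ a → (P a → a ∈ xs) × (a ∈ xs → P a))

-- Normalized volume (Jordan content via grid counting):
-- V = (n-1)! · lim_{t→∞} #{ z ∈ ℤ^(n-1) : z/t ∈ proj P } / t^(n-1).
NormalizedVolume : BorderStrip → ℚ → Set
NormalizedVolume p V =
  ∀ ε → 0ℚ <ℚ ε →
    ∃ λ T → ∀ t → T ≤ t →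
      ∃ λ k → IsCount (GridPoint p t) k ×
        (∣ (_/_ (+ ((dOf p) ! * k)) (suc t ^ dOf p) {{m^n≢0 (suc t) (dOf p)}}) - V ∣ <ℚ ε)

-- Standard Young tableaux of shape S(p).
-- A filling assigns to box i the label lookup v i ∈ Fin (m+r-1),
-- label j standing for the number j+1.
Filling : BorderStrip → Set
Filling p = Vec (Fin (nBoxes p)) (nBoxes p)

IsSYT : (p : BorderStrip) → Filling p → Set
IsSYT p v =
  (∀ i j → lookup v i ≡ lookup v j → i ≡ j) ×
  (∀ a → ∃ λ i → lookup v i ≡ a) ×
  (∀ i j → proj₂ (box p i) ≡ proj₂ (box p j) → proj₁ (box p i) < proj₁ (box p j) →
     lookup v i F.< lookup v j) ×
  (∀ i j → proj₁ (box p i) ≡ proj₁ (box p j) → proj₂ (box p i) < proj₂ (box p j) →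
     lookup v j F.< lookup v i)

-- Taking partial sums, a point x of P(S(p)) gives the vector (x₁ + ⋯ + x_k − h_k)_k, where h is the height of
-- the lower boundary path; as the two boundary paths of a border strip are one unit apart, this vector lies in the
-- order polytope of the d = n - 1 boxes, ordered by the tableau conditions (each box comes before its right
-- neighbour and after its upper neighbour). So the points of mesh 1/N of the projected polytope correspond to the
-- order-preserving maps from the boxes to {0, …, N}. Their number lies between e·C(N+1, d) and
-- e·C(N+1, d) + d²(N+1)^(d-1), where e is the number of linear extensions, i.e. of standard Young tableaux; hence
-- d! times this number, divided by N^d, tends to e.

module Submission where

open import Algebra.Bundles using (CommutativeMonoid)
open import Data.Bool using (Bool; true; false; T; not; if_then_else_; _xor_)
open import Data.Bool.Properties using (T-irrelevant; xor-comm)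
open import Data.Empty using (⊥-elim)
open import Data.Fin as Fin using (Fin; zero; suc; toℕ; fromℕ; fromℕ<; lower₁; inject₁; punchIn; punchOut)
open import Data.Fin.Properties as Finₚ using (all?; any?; 1↔⊤; +↔⊎; *↔×)
open import Data.Integer as ℤ using (ℤ; +_; -[1+_]; +[1+_])
import Data.Integer.Properties as ℤₚ
open import Data.Integer.Solver using () renaming (module +-*-Solver to ℤ-Solver)
open import Data.List as List using (List; []; _∷_; _++_; length; take; map)
import Data.List.Properties as Listₚ
open import Data.List.Membership.Propositional using (_∈_)
import Data.List.Membership.Propositional.Properties as ∈ₚ
open import Data.List.Relation.Unary.All as All using (All; []; _∷_)
import Data.List.Relation.Unary.Unique.Propositional.Properties as Uniqueₚ
open import Data.Nat using (ℕ; zero; suc; pred; _+_; _*_; _^_; _∸_; _⊓_; _!; _≤_; _<_; z≤n; s≤s; NonZero)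
open import Data.Nat.Combinatorics using (_C_; nCn≡1; nCk+nC[k+1]≡[n+1]C[k+1]; k>n⇒nCk≡0)
import Data.Nat.Properties as ℕₚ
open import Data.Nat.Solver using () renaming (module +-*-Solver to ℕ-Solver)
open import Data.Product using (Σ; ∃; ∃₂; _×_; _,_; proj₁; proj₂; uncurry)
open import Data.Product.Function.Dependent.Propositional using (Σ-↔)
open import Data.Product.Function.NonDependent.Propositional using (_×-↔_)
open import Data.Rational as ℚ using (ℚ; _/_; 0ℚ; 1ℚ; mkℚ)
import Data.Rational.Properties as ℚₚ
import Data.Rational.Unnormalised as ℚᵘ
import Data.Rational.Unnormalised.Properties as ℚᵘₚ
open import Data.Sum using (_⊎_; inj₁; inj₂)
open import Data.Sum.Function.Propositional using (_⊎-↔_)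
open import Data.Sum.Properties using (inj₁-injective; inj₂-injective)
open import Data.Unit using (tt)
open import Data.Vec as Vec using (Vec; []; _∷_; lookup)
import Data.Vec.Properties as Vecₚ
open import Function using (_∘_; id; _↔_; _↣_; mk↔ₛ′; mk↣; Inverse; Injection)
open import Function.Properties.Inverse using (↔-refl; ↔-sym; ↔-trans; ↔⇒↣)
open import Function.Properties.Injection using (↣-trans)
open import Relation.Binary.Definitions using (DecidableEquality)
open import Relation.Binary.PropositionalEquality
open import Relation.Nullary using (¬_; Dec; yes; no)
open import Relation.Nullary.Decidable using (⌊_⌋; toWitness; fromWitness; T?; ¬?; _×-dec_; _⊎-dec_; _→-dec_)

open import Algebra.Properties.CommutativeSemigroup ℕₚ.+-commutativeSemigroup
  using () renaming (interchange to +-interchangeℕ)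
open import Algebra.Properties.CommutativeSemigroup (CommutativeMonoid.commutativeSemigroup ℚₚ.+-0-commutativeMonoid)
  using () renaming (interchange to +-interchangeℚ)

open import Defs

private variable
  A B : Set
  d M : ℕ

Finite : Set → Set
Finite A = ∃ λ k → A ↔ Fin k

subtype-≡ : {P : A → Bool} {a a′ : A} {p : T (P a)} {p′ : T (P a′)} →
            a ≡ a′ → _≡_ {A = Σ A (T ∘ P)} (a , p) (a′ , p′)
subtype-≡ {a = a} refl = cong (a ,_) (T-irrelevant _ _)

Fin-cong : ∀ {m n} → m ≡ n → Fin m ↔ Fin n
Fin-cong refl = ↔-refl

Vec↔^ : ∀ M d → Vec (Fin M) d ↔ Fin (M ^ d)
Vec↔^ M zero    = ↔-trans (mk↔ₛ′ _ (λ _ → []) (λ _ → refl) λ { [] → refl }) (↔-sym 1↔⊤)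
Vec↔^ M (suc d) = ↔-trans (mk↔ₛ′ (λ { (x ∷ xs) → x , xs }) (uncurry _∷_) (λ _ → refl) λ { (x ∷ xs) → refl })
                          (↔-trans (↔-refl ×-↔ Vec↔^ M d) (↔-sym *↔×))

∑ : ∀ n → (Fin n → ℕ) → ℕ
∑ zero    k = 0
∑ (suc n) k = k zero + ∑ n (k ∘ suc)

∑-*-distribʳ : ∀ n (k : Fin n → ℕ) c → ∑ n (λ i → k i * c) ≡ ∑ n k * c
∑-*-distribʳ zero    k c = refl
∑-*-distribʳ (suc n) k c =
  trans (cong (λ v → k zero * c + v) (∑-*-distribʳ n (k ∘ suc) c)) (sym (ℕₚ.*-distribʳ-+ c (k zero) _))

Σ-Fin↔∑ : ∀ n {B : Fin n → Set} {k : Fin n → ℕ} → (∀ i → B i ↔ Fin (k i)) → Σ (Fin n) B ↔ Fin (∑ n k)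
Σ-Fin↔∑ zero    _ = mk↔ₛ′ (λ ()) (λ ()) (λ ()) (λ ())
Σ-Fin↔∑ (suc n) {B} e = ↔-trans Σ-suc (↔-trans (e zero ⊎-↔ Σ-Fin↔∑ n (e ∘ suc)) (↔-sym +↔⊎))
  where
  Σ-suc : Σ (Fin (suc n)) B ↔ (B zero ⊎ Σ (Fin n) (B ∘ suc))
  Σ-suc = mk↔ₛ′ (λ { (zero , b) → inj₁ b ; (suc i , b) → inj₂ (i , b) })
                (λ { (inj₁ b) → zero , b ; (inj₂ (i , b)) → suc i , b })
                (λ { (inj₁ b) → refl ; (inj₂ (i , b)) → refl })
                (λ { (zero , b) → refl ; (suc i , b) → refl })

T↔Fin : ∀ b → T b ↔ Fin (if b then 1 else 0)
T↔Fin true  = ↔-sym 1↔⊤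
T↔Fin false = mk↔ₛ′ (λ ()) (λ ()) (λ ()) (λ ())

T×↔Fin : ∀ b {X : Set} {k} → X ↔ Fin k → (T b × X) ↔ Fin (if b then k else 0)
T×↔Fin true  e = ↔-trans (mk↔ₛ′ proj₂ (tt ,_) (λ _ → refl) (λ _ → refl)) e
T×↔Fin false e = mk↔ₛ′ (λ ()) (λ ()) (λ ()) (λ ())

subtype-finite : Finite A → (P : A → Bool) → Finite (Σ A (T ∘ P))
subtype-finite (K , e) P =
  ∑ K (λ i → if P (from i) then 1 else 0) , ↔-trans (↔-sym (Σ-↔ (↔-sym e) ↔-refl)) (Σ-Fin↔∑ K (T↔Fin ∘ P ∘ from))
  where open Inverse e

card-mono : ∀ {a b} → A ↔ Fin a → B ↔ Fin b → A ↣ B → a ≤ b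
card-mono eA eB f = Finₚ.injective⇒≤ (Injection.injective (↣-trans (↔⇒↣ (↔-sym eA)) (↣-trans f (↔⇒↣ eB))))

isCount-image : (P : A → Bool) (g : A → B) (Q : B → Set) {k : ℕ} → Σ A (T ∘ P) ↔ Fin k →
  (∀ a a′ → T (P a) → T (P a′) → g a ≡ g a′ → a ≡ a′) →
  (∀ b → Q b → ∃ λ a → T (P a) × g a ≡ b) → (∀ a → T (P a) → Q (g a)) → IsCount Q k
isCount-image {A} {B} P g Q {k} e inj onto into =
  List.tabulate h , Uniqueₚ.tabulate⁺ h-injective , Listₚ.length-tabulate h , λ b → complete b , sound b
  where
  open Inverse e
  h : Fin k → B
  h = g ∘ proj₁ ∘ from
  h-injective : ∀ {i j} → h i ≡ h j → i ≡ j
  h-injective {i} {j} eq = begin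
    i               ≡⟨ sym (strictlyInverseˡ i) ⟩
    to (from i)     ≡⟨ cong to (subtype-≡ (inj _ _ (proj₂ (from i)) (proj₂ (from j)) eq)) ⟩
    to (from j)     ≡⟨ strictlyInverseˡ j ⟩
    j               ∎
    where open ≡-Reasoning
  complete : ∀ b → Q b → b ∈ List.tabulate h
  complete b q with onto b q
  ... | a , pa , refl = subst (_∈ List.tabulate h) (cong (g ∘ proj₁) (strictlyInverseʳ (a , pa)))
                              (∈ₚ.∈-tabulate⁺ (to (a , pa)))
  sound : ∀ b → b ∈ List.tabulate h → Q b
  sound b b∈ with ∈ₚ.∈-tabulate⁻ b∈
  ... | i , refl = into _ (proj₂ (from i))

-- Labellings and order maps of a digraph

Digraph : ℕ → Set
Digraph d = Fin d → Fin d → Bool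

Distinct : Vec (Fin M) d → Set
Distinct y = ∀ i j → lookup y i ≡ lookup y j → i ≡ j

Increasing : Digraph d → Vec (Fin M) d → Set
Increasing G y = ∀ i j → T (G i j) → lookup y i Fin.< lookup y j

Monotone : Digraph d → Vec (Fin M) d → Set
Monotone G y = ∀ i j → T (G i j) → lookup y i Fin.≤ lookup y j

-- Opaque, so that type checking never unfolds the decision procedures.
opaque
  isLabelling : Digraph d → Vec (Fin M) d → Bool
  isLabelling G y = ⌊ (all? λ i → all? λ j → (lookup y i Fin.≟ lookup y j) →-dec (i Fin.≟ j))
                  ×-dec (all? λ i → all? λ j → T? (G i j) →-dec (lookup y i Finₚ.<? lookup y j)) ⌋

  isLabelling⇒ : {G : Digraph d} {y : Vec (Fin M) d} → T (isLabelling G y) → Distinct y × Increasing G y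
  isLabelling⇒ = toWitness

  ⇒isLabelling : {G : Digraph d} {y : Vec (Fin M) d} → Distinct y × Increasing G y → T (isLabelling G y)
  ⇒isLabelling = fromWitness

  isMonotone : Digraph d → Vec (Fin M) d → Bool
  isMonotone G y = ⌊ all? (λ i → all? λ j → T? (G i j) →-dec (lookup y i Finₚ.≤? lookup y j)) ⌋

  isMonotone⇒ : {G : Digraph d} {y : Vec (Fin M) d} → T (isMonotone G y) → Monotone G y
  isMonotone⇒ = toWitness

  ⇒isMonotone : {G : Digraph d} {y : Vec (Fin M) d} → Monotone G y → T (isMonotone G y)
  ⇒isMonotone = fromWitness

  isSink : Digraph d → Fin d → Bool
  isSink G i = ⌊ all? (λ j → ¬? (T? (G i j))) ⌋

  isSink⇒ : {G : Digraph d} {i : Fin d} → T (isSink G i) → ∀ j → ¬ T (G i j)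
  isSink⇒ = toWitness

  ⇒isSink : {G : Digraph d} {i : Fin d} → (∀ j → ¬ T (G i j)) → T (isSink G i)
  ⇒isSink = fromWitness

Labelling : Digraph d → ℕ → Set
Labelling {d} G M = Σ (Vec (Fin M) d) (T ∘ isLabelling G)

OrderMap : Digraph d → ℕ → Set
OrderMap {d} G M = Σ (Vec (Fin M) d) (T ∘ isMonotone G)

_∖_ : Digraph (suc d) → Fin (suc d) → Digraph d
(G ∖ i) a b = G (punchIn i a) (punchIn i b)

extensions : ∀ d → Digraph d → ℕ
extensions zero    G = 1
extensions (suc d) G = ∑ (suc d) λ i → if isSink G i then extensions d (G ∖ i) else 0

≡-lookup : ∀ {A : Set} {n} {xs ys : Vec A n} → (∀ i → lookup xs i ≡ lookup ys i) → xs ≡ ys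
≡-lookup {xs = xs} {ys} eq =
  trans (sym (Vecₚ.tabulate∘lookup xs)) (trans (Vecₚ.tabulate-cong eq) (Vecₚ.tabulate∘lookup ys))

punchIn-view : ∀ {n} (i k : Fin (suc n)) → k ≡ i ⊎ ∃ λ j → k ≡ punchIn i j
punchIn-view i k with k Fin.≟ i
... | yes k≡i = inj₁ k≡i
... | no  k≢i = inj₂ (punchOut (k≢i ∘ sym) , sym (Finₚ.punchIn-punchOut (k≢i ∘ sym)))

labelling-resp-toℕ : ∀ {M′} {G : Digraph d} {y : Vec (Fin M) d} {y′ : Vec (Fin M′) d} →
  (∀ j → toℕ (lookup y′ j) ≡ toℕ (lookup y j)) → Distinct y × Increasing G y → Distinct y′ × Increasing G y′
labelling-resp-toℕ eq (distinct , increasing) =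
  (λ i j e → distinct i j (Finₚ.toℕ-injective (trans (sym (eq i)) (trans (cong toℕ e) (eq j))))) ,
  (λ i j g → subst₂ _<_ (sym (eq i)) (sym (eq j)) (increasing i j g))

-- A labelling by {0,…,M} either avoids M, or gives it to exactly one vertex, necessarily a sink.
module TopLabel {d M : ℕ} (G : Digraph (suc d)) where

  top : Fin (suc M)
  top = fromℕ M

  TopAtSink : Set
  TopAtSink = Σ (Fin (suc d)) λ i → T (isSink G i) × Labelling (G ∖ i) M

  toℕ-top : ∀ {x} → x ≡ top → toℕ x ≡ M
  toℕ-top refl = Finₚ.toℕ-fromℕ M

  lower : (x : Fin (suc M)) → x ≢ top → Fin M
  lower x x≢top = lower₁ x λ e → x≢top (Finₚ.toℕ-injective (trans (sym e) (sym (Finₚ.toℕ-fromℕ M))))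

  lowerAll : (y : Vec (Fin (suc M)) (suc d)) → ¬ (∃ λ i → lookup y i ≡ top) → Vec (Fin M) (suc d)
  lowerAll y miss = Vec.tabulate λ j → lower (lookup y j) (λ e → miss (j , e))

  toℕ-lowerAll : ∀ y miss j → toℕ (lookup (lowerAll y miss) j) ≡ toℕ (lookup y j)
  toℕ-lowerAll y miss j =
    trans (cong toℕ (Vecₚ.lookup∘tabulate (λ j → lower (lookup y j) (λ e → miss (j , e))) j))
          (Finₚ.toℕ-lower₁ (lookup y j) _)

  module _ (y : Vec (Fin (suc M)) (suc d)) (ℓ : Distinct y × Increasing G y) (i : Fin (suc d))
           (yᵢ≡top : lookup y i ≡ top) where

    top-at-sink : ∀ j → ¬ T (G i j)
    top-at-sink j g = ℕₚ.<⇒≱ (subst (_< toℕ (lookup y j)) (toℕ-top yᵢ≡top) (proj₂ ℓ i j g))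
                             (ℕₚ.≤-pred (Finₚ.toℕ<n (lookup y j)))

    below-top : ∀ j → lookup y (punchIn i j) ≢ top
    below-top j e = Finₚ.punchInᵢ≢i i j (proj₁ ℓ _ _ (trans e (sym yᵢ≡top)))

    removeTop : Vec (Fin M) d
    removeTop = Vec.tabulate λ j → lower (lookup y (punchIn i j)) (below-top j)

    toℕ-removeTop : ∀ j → toℕ (lookup removeTop j) ≡ toℕ (lookup y (punchIn i j))
    toℕ-removeTop j =
      trans (cong toℕ (Vecₚ.lookup∘tabulate (λ j → lower (lookup y (punchIn i j)) (below-top j)) j))
            (Finₚ.toℕ-lower₁ (lookup y (punchIn i j)) _)

    removeTop-labelling : Distinct removeTop × Increasing (G ∖ i) removeTop
    removeTop-labelling =
      (λ a b e → Finₚ.punchIn-injective i a b (proj₁ ℓ _ _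
         (Finₚ.toℕ-injective (trans (sym (toℕ-removeTop a)) (trans (cong toℕ e) (toℕ-removeTop b)))))) ,
      (λ a b g → subst₂ _<_ (sym (toℕ-removeTop a)) (sym (toℕ-removeTop b)) (proj₂ ℓ _ _ g))

  classify : (y : Vec (Fin (suc M)) (suc d)) → T (isLabelling G y) → Dec (∃ λ i → lookup y i ≡ top) →
             Labelling G M ⊎ TopAtSink
  classify y ok (no miss) =
    inj₁ (lowerAll y miss , ⇒isLabelling (labelling-resp-toℕ {y = y} {y′ = lowerAll y miss} (toℕ-lowerAll y miss) (isLabelling⇒ ok)))
  classify y ok (yes (i , e)) =
    inj₂ (i , ⇒isSink (top-at-sink y (isLabelling⇒ ok) i e) ,
          removeTop y (isLabelling⇒ ok) i e , ⇒isLabelling (removeTop-labelling y (isLabelling⇒ ok) i e))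

  to : Labelling G (suc M) → Labelling G M ⊎ TopAtSink
  to (y , ok) = classify y ok (any? λ i → lookup y i Fin.≟ top)

  toℕ-inject : ∀ {n} (y : Vec (Fin M) n) j → toℕ (lookup (Vec.map inject₁ y) j) ≡ toℕ (lookup y j)
  toℕ-inject y j = trans (cong toℕ (Vecₚ.lookup-map j inject₁ y)) (Finₚ.toℕ-inject₁ _)

  insertTop : Fin (suc d) → Vec (Fin M) d → Vec (Fin (suc M)) (suc d)
  insertTop i y = Vec.insertAt (Vec.map inject₁ y) i top

  insertTop-at : ∀ i y → lookup (insertTop i y) i ≡ top
  insertTop-at i y = Vecₚ.insertAt-lookup _ i top

  insertTop-punchIn : ∀ i y j → lookup (insertTop i y) (punchIn i j) ≡ inject₁ (lookup y j)
  insertTop-punchIn i y j = trans (Vecₚ.insertAt-punchIn _ i top j) (Vecₚ.lookup-map j inject₁ y)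

  insertTop-labelling : ∀ i → (∀ j → ¬ T (G i j)) → ∀ y → Distinct y × Increasing (G ∖ i) y →
                        Distinct (insertTop i y) × Increasing G (insertTop i y)
  insertTop-labelling i sink y (distinct , increasing) = distinct′ , increasing′
    where
    distinct′ : Distinct (insertTop i y)
    distinct′ a b e with punchIn-view i a | punchIn-view i b
    ... | inj₁ refl | inj₁ refl = refl
    ... | inj₁ refl | inj₂ (b′ , refl) =
      ⊥-elim (Finₚ.fromℕ≢inject₁ (trans (sym (insertTop-at i y)) (trans e (insertTop-punchIn i y b′))))
    ... | inj₂ (a′ , refl) | inj₁ refl =
      ⊥-elim (Finₚ.fromℕ≢inject₁ (trans (sym (insertTop-at i y)) (trans (sym e) (insertTop-punchIn i y a′))))
    ... | inj₂ (a′ , refl) | inj₂ (b′ , refl) = cong (punchIn i) (distinct a′ b′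
      (Finₚ.inject₁-injective (trans (sym (insertTop-punchIn i y a′)) (trans e (insertTop-punchIn i y b′)))))
    toℕ-insertTop : ∀ a → toℕ (lookup (insertTop i y) (punchIn i a)) ≡ toℕ (lookup y a)
    toℕ-insertTop a = trans (cong toℕ (insertTop-punchIn i y a)) (Finₚ.toℕ-inject₁ _)
    increasing′ : Increasing G (insertTop i y)
    increasing′ a b g with punchIn-view i a | punchIn-view i b
    ... | inj₁ refl | _ = ⊥-elim (sink b g)
    ... | inj₂ (a′ , refl) | inj₁ refl =
      subst₂ _<_ (sym (toℕ-insertTop a′)) (sym (toℕ-top (insertTop-at i y))) (Finₚ.toℕ<n (lookup y a′))
    ... | inj₂ (a′ , refl) | inj₂ (b′ , refl) =
      subst₂ _<_ (sym (toℕ-insertTop a′)) (sym (toℕ-insertTop b′)) (increasing a′ b′ g)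

  from : Labelling G M ⊎ TopAtSink → Labelling G (suc M)
  from (inj₁ (y , ok)) =
    Vec.map inject₁ y , ⇒isLabelling (labelling-resp-toℕ {y = y} {y′ = Vec.map inject₁ y} (toℕ-inject y) (isLabelling⇒ ok))
  from (inj₂ (i , sink , y , ok)) =
    insertTop i y , ⇒isLabelling (insertTop-labelling i (isSink⇒ sink) y (isLabelling⇒ ok))

  from∘to : ∀ x → from (to x) ≡ x
  from∘to (y , ok) = go (any? λ i → lookup y i Fin.≟ top)
    where
    go : ∀ top? → from (classify y ok top?) ≡ (y , ok)
    go (no miss) = subtype-≡ (≡-lookup λ j →
      Finₚ.toℕ-injective (trans (toℕ-inject (lowerAll y miss) j) (toℕ-lowerAll y miss j)))
    go (yes (i , e)) = subtype-≡ (≡-lookup at)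
      where
      at : ∀ k → lookup (insertTop i (removeTop y (isLabelling⇒ ok) i e)) k ≡ lookup y k
      at k with punchIn-view i k
      ... | inj₁ refl = trans (insertTop-at i _) (sym e)
      ... | inj₂ (j , refl) = Finₚ.toℕ-injective (trans (cong toℕ (insertTop-punchIn i _ j))
          (trans (Finₚ.toℕ-inject₁ _) (toℕ-removeTop y (isLabelling⇒ ok) i e j)))

  topAtSink-≡ : ∀ i (s s′ : T (isSink G i)) (a b : Labelling (G ∖ i) M) → proj₁ a ≡ proj₁ b →
                _≡_ {A = Labelling G M ⊎ TopAtSink} (inj₂ (i , s , a)) (inj₂ (i , s′ , b))
  topAtSink-≡ i s s′ (y , ok) (.y , ok′) refl with T-irrelevant s s′ | T-irrelevant ok ok′
  ... | refl | refl = refl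

  to∘from : ∀ x → to (from x) ≡ x
  to∘from (inj₁ (y , ok)) = go (any? λ i → lookup (Vec.map inject₁ y) i Fin.≟ top)
    where
    go : ∀ top? → classify (Vec.map inject₁ y) (proj₂ (from (inj₁ (y , ok)))) top? ≡ inj₁ (y , ok)
    go (yes (i , e)) = ⊥-elim (Finₚ.fromℕ≢inject₁ (trans (sym e) (Vecₚ.lookup-map i inject₁ y)))
    go (no miss) = cong inj₁ (subtype-≡ (≡-lookup λ j →
      Finₚ.toℕ-injective (trans (toℕ-lowerAll (Vec.map inject₁ y) miss j) (toℕ-inject y j))))
  to∘from (inj₂ (i , sink , y , ok)) = go (any? λ k → lookup (insertTop i y) k Fin.≟ top)
    where
    ℓ = insertTop-labelling i (isSink⇒ sink) y (isLabelling⇒ ok)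
    go : ∀ top? → classify (insertTop i y) (⇒isLabelling ℓ) top? ≡ inj₂ (i , sink , y , ok)
    go (no miss) = ⊥-elim (miss (i , insertTop-at i y))
    go (yes (k , e)) with punchIn-view i k
    ... | inj₂ (j , refl) = ⊥-elim (Finₚ.fromℕ≢inject₁ (trans (sym e) (insertTop-punchIn i y j)))
    ... | inj₁ refl = topAtSink-≡ i _ sink _ (y , ok) (≡-lookup λ j → Finₚ.toℕ-injective
          (trans (toℕ-removeTop (insertTop i y) (isLabelling⇒ (⇒isLabelling {G = G} {y = insertTop i y} ℓ)) i e j)
          (trans (cong toℕ (insertTop-punchIn i y j)) (Finₚ.toℕ-inject₁ (lookup y j)))))

  split : Labelling G (suc M) ↔ (Labelling G M ⊎ TopAtSink)
  split = mk↔ₛ′ to from to∘from from∘to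

labellings↔ : ∀ d (G : Digraph d) M → Labelling G M ↔ Fin (extensions d G * (M C d))
labellings↔ zero    G M =
  mk↔ₛ′ (λ _ → zero) (λ _ → [] , ⇒isLabelling ((λ ()) , (λ ()))) (λ { zero → refl }) (λ { ([] , _) → subtype-≡ refl })
labellings↔ (suc d) G zero = ↔-trans (mk↔ₛ′ (λ { (() ∷ _ , _) }) (λ ()) (λ ()) (λ { (() ∷ _ , _) }))
  (Fin-cong (sym (trans (cong (extensions (suc d) G *_) (k>n⇒nCk≡0 {0} {suc d} (s≤s z≤n))) (ℕₚ.*-zeroʳ (extensions (suc d) G)))))
labellings↔ (suc d) G (suc M) =
  ↔-trans (TopLabel.split G)
  (↔-trans (labellings↔ (suc d) G M ⊎-↔ Σ-Fin↔∑ (suc d) (λ i → T×↔Fin (isSink G i) (labellings↔ d (G ∖ i) M)))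
  (↔-trans (↔-sym +↔⊎) (Fin-cong count)))
  where
  e = extensions (suc d) G
  count : e * (M C suc d) + ∑ (suc d) (λ i → if isSink G i then extensions d (G ∖ i) * (M C d) else 0)
        ≡ e * (suc M C suc d)
  count = begin
    e * (M C suc d) + ∑ (suc d) (λ i → if isSink G i then extensions d (G ∖ i) * (M C d) else 0)
      ≡⟨ cong (λ v → e * (M C suc d) + v)
              (trans (∑-cong λ i → if-* (isSink G i) {extensions d (G ∖ i)} {M C d}) (∑-*-distribʳ (suc d) k (M C d))) ⟩
    e * (M C suc d) + e * (M C d)  ≡⟨ ℕₚ.+-comm (e * (M C suc d)) _ ⟩
    e * (M C d) + e * (M C suc d)  ≡⟨ sym (ℕₚ.*-distribˡ-+ e (M C d) _) ⟩
    e * (M C d + M C suc d)        ≡⟨ cong (e *_) (nCk+nC[k+1]≡[n+1]C[k+1] M d) ⟩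
    e * (suc M C suc d)            ∎
    where
    open ≡-Reasoning
    k : Fin (suc d) → ℕ
    k i = if isSink G i then extensions d (G ∖ i) else 0
    if-* : ∀ b {x c} → (if b then x * c else 0) ≡ (if b then x else 0) * c
    if-* true  = refl
    if-* false = refl
    ∑-cong : ∀ {n} {f g : Fin n → ℕ} → (∀ i → f i ≡ g i) → ∑ n f ≡ ∑ n g
    ∑-cong {zero}  eq = refl
    ∑-cong {suc n} eq = cong₂ _+_ (eq zero) (∑-cong (eq ∘ suc))

labellings↔extensions : ∀ d (G : Digraph d) → Labelling G d ↔ Fin (extensions d G)
labellings↔extensions d G =
  ↔-trans (labellings↔ d G d) (Fin-cong (trans (cong (extensions d G *_) (nCn≡1 d)) (ℕₚ.*-identityʳ _)))

orderMaps-finite : ∀ {d} (G : Digraph d) M → Finite (OrderMap G M)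
orderMaps-finite {d} G M = subtype-finite (M ^ d , Vec↔^ M d) (isMonotone G)

#orderMaps : ∀ {d} → Digraph d → ℕ → ℕ
#orderMaps G M = proj₁ (orderMaps-finite G M)

module _ {L : ℕ} (G : Digraph (suc L)) (M : ℕ) where

  labelling↣orderMap : Labelling G M ↣ OrderMap G M
  labelling↣orderMap = mk↣ {to = λ (y , ok) → y , ⇒isMonotone λ i j g → ℕₚ.<⇒≤ (proj₂ (isLabelling⇒ ok) i j g)}
                            λ eq → subtype-≡ (cong proj₁ eq)

  orderMaps-lower : extensions (suc L) G * (M C suc L) ≤ #orderMaps G M
  orderMaps-lower = card-mono (labellings↔ (suc L) G M) (proj₂ (orderMaps-finite G M)) labelling↣orderMap

  Collision : Vec (Fin M) (suc L) → Set
  Collision y = ∃₂ λ i j → lookup y i ≡ lookup y j × i ≢ j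

  collision? : (y : Vec (Fin M) (suc L)) → Dec (Collision y)
  collision? y = any? λ i → any? λ j → (lookup y i Fin.≟ lookup y j) ×-dec ¬? (i Fin.≟ j)

  -- A colliding map is recovered from the two colliding positions and its values elsewhere.
  reinsert : (y : Vec (Fin M) (suc L)) (i j : Fin (suc L)) → lookup y i ≡ lookup y j → (i≢j : i ≢ j) →
             y ≡ Vec.insertAt (Vec.removeAt y j) j (lookup (Vec.removeAt y j) (punchOut (i≢j ∘ sym)))
  reinsert y i j yᵢ≡yⱼ i≢j = trans (sym (Vecₚ.insertAt-removeAt y j))
    (cong (Vec.insertAt (Vec.removeAt y j) j) (trans (sym yᵢ≡yⱼ) (sym (Vecₚ.removeAt-punchOut y (i≢j ∘ sym)))))

  module _ (irreflexive : ∀ i → ¬ T (G i i)) where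

    Code : Set
    Code = Labelling G M ⊎ (Fin (suc L) × Fin (suc L) × Vec (Fin M) L)

    encode : (y : Vec (Fin M) (suc L)) → T (isMonotone G y) → Dec (Collision y) → Code
    encode y _ (yes (i , j , _ , _)) = inj₂ (i , j , Vec.removeAt y j)
    encode y mono (no none) = inj₁ (y , ⇒isLabelling (distinct , increasing))
      where
      distinct : Distinct y
      distinct i j e with i Fin.≟ j
      ... | yes i≡j = i≡j
      ... | no  i≢j = ⊥-elim (none (i , j , e , i≢j))
      increasing : Increasing G y
      increasing i j g = ℕₚ.≤∧≢⇒< (isMonotone⇒ mono i j g)
        λ e → irreflexive i (subst (T ∘ G i) (sym (distinct i j (Finₚ.toℕ-injective e))) g)

    encode-injective : ∀ y y′ m m′ c c′ → encode y m c ≡ encode y′ m′ c′ → y ≡ y′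
    encode-injective y y′ m m′ (no _) (no _) eq = cong proj₁ (inj₁-injective eq)
    encode-injective y y′ m m′ (yes (i , j , e , i≢j)) (yes (i′ , j′ , e′ , i≢j′)) eq
      with inj₂-injective eq
    ... | codes≡ = go (cong proj₁ codes≡) (cong (proj₁ ∘ proj₂) codes≡) (cong (proj₂ ∘ proj₂) codes≡) e′ i≢j′
      where
      go : i ≡ i′ → j ≡ j′ → Vec.removeAt y j ≡ Vec.removeAt y′ j′ →
           (e′ : lookup y′ i′ ≡ lookup y′ j′) (i≢j′ : i′ ≢ j′) → y ≡ y′
      go refl refl r e′ i≢j′ = trans (reinsert y i j e i≢j)
        (trans (cong₂ (λ v k → Vec.insertAt v j (lookup v k)) r (Finₚ.punchOut-cong j refl))
               (sym (reinsert y′ i j e′ i≢j′)))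
    encode-injective y y′ m m′ (no _) (yes _) ()
    encode-injective y y′ m m′ (yes _) (no _) ()

    orderMap↣code : OrderMap G M ↣ Code
    orderMap↣code = mk↣ {to = λ (y , m) → encode y m (collision? y)}
      λ {(y , m)} {(y′ , m′)} eq → subtype-≡ (encode-injective y y′ m m′ _ _ eq)

    orderMaps-upper : #orderMaps G M ≤ extensions (suc L) G * (M C suc L) + suc L * (suc L * M ^ L)
    orderMaps-upper = card-mono (proj₂ (orderMaps-finite G M))
      (↔-trans (labellings↔ (suc L) G M ⊎-↔
                ↔-trans (↔-refl ×-↔ ↔-trans (↔-refl ×-↔ Vec↔^ M L) (↔-sym *↔×)) (↔-sym *↔×))
               (↔-sym +↔⊎))
      orderMap↣code

-- Border strips and standard Young tableaux

boolToℕ : Bool → ℕ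
boolToℕ true  = 1
boolToℕ false = 0

_≟ˢ_ : DecidableEquality Step
R ≟ˢ R = yes refl
R ≟ˢ U = no λ ()
U ≟ˢ R = no λ ()
U ≟ˢ U = yes refl

stepAt : BorderStrip → ℕ → Step
stepAt []      k       = R
stepAt (s ∷ p) zero    = s
stepAt (s ∷ p) (suc k) = stepAt p k

column row : BorderStrip → ℕ → ℕ
column p k = countR (take k p)
row    p k = countU (take k p)

box≡ : ∀ p i → box p i ≡ (column p (toℕ i) , row p (toℕ i))
box≡ p i = go p 0 0 i
  where
  go : ∀ s x y (i : Fin (suc (length s))) →
       lookup (boxesFrom s x y) i ≡ (x + countR (take (toℕ i) s) , y + countU (take (toℕ i) s))
  go []      x y zero    = cong₂ _,_ (sym (ℕₚ.+-identityʳ x)) (sym (ℕₚ.+-identityʳ y))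
  go (R ∷ s) x y zero    = cong₂ _,_ (sym (ℕₚ.+-identityʳ x)) (sym (ℕₚ.+-identityʳ y))
  go (U ∷ s) x y zero    = cong₂ _,_ (sym (ℕₚ.+-identityʳ x)) (sym (ℕₚ.+-identityʳ y))
  go (R ∷ s) x y (suc i) = trans (go s (suc x) y i) (cong₂ _,_ (sym (ℕₚ.+-suc x _)) refl)
  go (U ∷ s) x y (suc i) = trans (go s x (suc y) i) (cong₂ _,_ refl (sym (ℕₚ.+-suc y _)))

column-suc : ∀ p k → k < length p → column p (suc k) ≡ column p k + boolToℕ (not (isU (stepAt p k)))
column-suc (R ∷ p) zero    _        = refl
column-suc (U ∷ p) zero    _        = refl
column-suc (R ∷ p) (suc k) (s≤s k<) = cong suc (column-suc p k k<)
column-suc (U ∷ p) (suc k) (s≤s k<) = column-suc p k k<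

row-suc : ∀ p k → k < length p → row p (suc k) ≡ row p k + boolToℕ (isU (stepAt p k))
row-suc (R ∷ p) zero    _        = refl
row-suc (U ∷ p) zero    _        = refl
row-suc (R ∷ p) (suc k) (s≤s k<) = row-suc p k k<
row-suc (U ∷ p) (suc k) (s≤s k<) = cong suc (row-suc p k k<)

column-mono : ∀ p {a b} → a ≤ b → column p a ≤ column p b
column-mono _       {zero}          _         = z≤n
column-mono []      {suc a} {suc b} _         = z≤n
column-mono (R ∷ p) {suc a} {suc b} (s≤s a≤b) = s≤s (column-mono p a≤b)
column-mono (U ∷ p) {suc a} {suc b} (s≤s a≤b) = column-mono p a≤b

row-mono : ∀ p {a b} → a ≤ b → row p a ≤ row p b
row-mono _       {zero}          _         = z≤n
row-mono []      {suc a} {suc b} _         = z≤n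
row-mono (R ∷ p) {suc a} {suc b} (s≤s a≤b) = row-mono p a≤b
row-mono (U ∷ p) {suc a} {suc b} (s≤s a≤b) = s≤s (row-mono p a≤b)

-- Box i+1 lies right of box i (step R) or above it (step U); tableau labels increase in the first case and decrease
-- in the second.
CoverEdge : (p : BorderStrip) → Fin (nBoxes p) → Fin (nBoxes p) → Set
CoverEdge p i j = (toℕ j ≡ suc (toℕ i) × stepAt p (toℕ i) ≡ R) ⊎ (toℕ i ≡ suc (toℕ j) × stepAt p (toℕ j) ≡ U)

opaque
  coverGraph : (p : BorderStrip) → Digraph (nBoxes p)
  coverGraph p i j = ⌊ (toℕ j ℕₚ.≟ suc (toℕ i) ×-dec stepAt p (toℕ i) ≟ˢ R)
                   ⊎-dec (toℕ i ℕₚ.≟ suc (toℕ j) ×-dec stepAt p (toℕ j) ≟ˢ U) ⌋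

  coverGraph⇒ : ∀ {p i j} → T (coverGraph p i j) → CoverEdge p i j
  coverGraph⇒ = toWitness

  ⇒coverGraph : ∀ {p i j} → CoverEdge p i j → T (coverGraph p i j)
  ⇒coverGraph = fromWitness

coverGraph-irreflexive : ∀ p i → ¬ T (coverGraph p i i)
coverGraph-irreflexive p i e with coverGraph⇒ e
... | inj₁ (eq , _) = ℕₚ.1+n≢n (sym eq)
... | inj₂ (eq , _) = ℕₚ.1+n≢n (sym eq)

step-bound : ∀ p (i j : Fin (nBoxes p)) → toℕ j ≡ suc (toℕ i) → toℕ i < length p
step-bound p i j j≡ = ℕₚ.≤-pred (subst (_< suc (length p)) j≡ (Finₚ.toℕ<n j))

constant-chain : ∀ {n} (c : ℕ → ℕ) → (∀ {a b} → a ≤ b → c a ≤ c b) → (W : Fin n → Fin n → Set) →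
  (∀ {a b e} → W a b → W b e → W a e) → (∀ i j → toℕ j ≡ suc (toℕ i) → c (toℕ i) ≡ c (toℕ j) → W i j) →
  ∀ i j → toℕ i < toℕ j → c (toℕ i) ≡ c (toℕ j) → W i j
constant-chain {n} c mono W W-trans step i j i<j cᵢ≡cⱼ = go (proj₁ gap) j (proj₂ gap) cᵢ≡cⱼ
  where
  gap : ∃ λ g → suc (toℕ i + g) ≡ toℕ j
  gap = ℕₚ.m≤n⇒∃[o]m+o≡n i<j
  go : ∀ g j → suc (toℕ i + g) ≡ toℕ j → c (toℕ i) ≡ c (toℕ j) → W i j
  go zero    j eq cᵢ≡cⱼ = step i j (trans (sym eq) (cong suc (ℕₚ.+-identityʳ (toℕ i)))) cᵢ≡cⱼ
  go (suc g) j eq cᵢ≡cⱼ = W-trans (go g m (sym m≡) cᵢ≡cₘ) (step m j j≡ cₘ≡cⱼ)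
    where
    m<j : suc (toℕ i + g) < toℕ j
    m<j = ℕₚ.≤-reflexive (trans (cong suc (sym (ℕₚ.+-suc (toℕ i) g))) eq)
    m = fromℕ< (ℕₚ.<-trans m<j (Finₚ.toℕ<n j))
    m≡ : toℕ m ≡ suc (toℕ i + g)
    m≡ = Finₚ.toℕ-fromℕ< _
    j≡ : toℕ j ≡ suc (toℕ m)
    j≡ = trans (sym eq) (cong suc (trans (ℕₚ.+-suc (toℕ i) g) (sym m≡)))
    cᵢ≤cₘ : c (toℕ i) ≤ c (toℕ m)
    cᵢ≤cₘ = mono (subst (toℕ i ≤_) (sym m≡) (ℕₚ.≤-trans (ℕₚ.m≤m+n (toℕ i) g) (ℕₚ.n≤1+n _)))
    cₘ≤cⱼ : c (toℕ m) ≤ c (toℕ j)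
    cₘ≤cⱼ = mono (subst (toℕ m ≤_) (sym j≡) (ℕₚ.n≤1+n _))
    cᵢ≡cₘ : c (toℕ i) ≡ c (toℕ m)
    cᵢ≡cₘ = ℕₚ.≤-antisym cᵢ≤cₘ (subst (c (toℕ m) ≤_) (sym cᵢ≡cⱼ) cₘ≤cⱼ)
    cₘ≡cⱼ : c (toℕ m) ≡ c (toℕ j)
    cₘ≡cⱼ = trans (sym cᵢ≡cₘ) cᵢ≡cⱼ

row-R : ∀ p k → k < length p → stepAt p k ≡ R → row p (suc k) ≡ row p k
row-R p k k< sR = trans (row-suc p k k<) (trans (cong (λ s → row p k + boolToℕ (isU s)) sR) (ℕₚ.+-identityʳ _))

row-U : ∀ p k → k < length p → stepAt p k ≡ U → row p (suc k) ≡ suc (row p k)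
row-U p k k< sU = trans (row-suc p k k<) (trans (cong (λ s → row p k + boolToℕ (isU s)) sU) (ℕₚ.+-comm _ 1))

column-R : ∀ p k → k < length p → stepAt p k ≡ R → column p (suc k) ≡ suc (column p k)
column-R p k k< sR =
  trans (column-suc p k k<) (trans (cong (λ s → column p k + boolToℕ (not (isU s))) sR) (ℕₚ.+-comm _ 1))

column-U : ∀ p k → k < length p → stepAt p k ≡ U → column p (suc k) ≡ column p k
column-U p k k< sU =
  trans (column-suc p k k<) (trans (cong (λ s → column p k + boolToℕ (not (isU s))) sU) (ℕₚ.+-identityʳ _))

row-≡⇒R : ∀ p k → k < length p → row p k ≡ row p (suc k) → stepAt p k ≡ R
row-≡⇒R p k k< eq with stepAt p k in s
... | R = refl
... | U = ⊥-elim (ℕₚ.1+n≢n (sym (trans eq (row-U p k k< s))))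

column-≡⇒U : ∀ p k → k < length p → column p k ≡ column p (suc k) → stepAt p k ≡ U
column-≡⇒U p k k< eq with stepAt p k in s
... | U = refl
... | R = ⊥-elim (ℕₚ.1+n≢n (sym (trans eq (column-R p k k< s))))

monotone-reflects-< : (c : ℕ → ℕ) → (∀ {a b} → a ≤ b → c a ≤ c b) → ∀ {a b} → c a < c b → a < b
monotone-reflects-< c mono {a} {b} ca<cb with a ℕₚ.<? b
... | yes a<b = a<b
... | no  a≮b = ⊥-elim (ℕₚ.<⇒≱ ca<cb (mono (ℕₚ.≮⇒≥ a≮b)))

distinct⇒surjective : ∀ {n} (v : Vec (Fin n) n) → Distinct v → ∀ a → ∃ λ i → lookup v i ≡ a
distinct⇒surjective {suc n} v distinct a with any? (λ i → lookup v i Fin.≟ a)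
... | yes hit = hit
... | no  miss = ⊥-elim (ℕₚ.<-irrefl refl (Finₚ.injective⇒≤ f-injective))
  where
  f : Fin (suc n) → Fin n
  f i = punchOut {i = a} {j = lookup v i} (λ e → miss (i , sym e))
  f-injective : ∀ {x y} → f x ≡ f y → x ≡ y
  f-injective {x} {y} eq = distinct _ _ (Finₚ.punchOut-injective (λ e → miss (x , sym e)) (λ e → miss (y , sym e)) eq)

module _ (p : BorderStrip) where

  private
    columnOf : ∀ i → proj₁ (box p i) ≡ column p (toℕ i)
    columnOf i = cong proj₁ (box≡ p i)
    rowOf : ∀ i → proj₂ (box p i) ≡ row p (toℕ i)
    rowOf i = cong proj₂ (box≡ p i)

  syt⇒labelling : ∀ v → IsSYT p v → Distinct v × Increasing (coverGraph p) v
  syt⇒labelling v (distinct , _ , rows , columns) = distinct , increasing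
    where
    increasing : Increasing (coverGraph p) v
    increasing i j e with coverGraph⇒ e
    ... | inj₁ (j≡ , sR) = rows i j
      (trans (rowOf i) (trans (sym (row-R p _ k< sR)) (trans (cong (row p) (sym j≡)) (sym (rowOf j)))))
      (subst₂ _<_ (sym (columnOf i)) (trans (sym (column-R p _ k< sR)) (trans (cong (column p) (sym j≡)) (sym (columnOf j))))
              (ℕₚ.n<1+n _))
      where k< = step-bound p i j j≡
    ... | inj₂ (i≡ , sU) = columns j i
      (trans (columnOf j) (trans (sym (column-U p _ k< sU)) (trans (cong (column p) (sym i≡)) (sym (columnOf i)))))
      (subst₂ _<_ (sym (rowOf j)) (trans (sym (row-U p _ k< sU)) (trans (cong (row p) (sym i≡)) (sym (rowOf i))))
              (ℕₚ.n<1+n _))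
      where k< = step-bound p j i i≡

  labelling⇒syt : ∀ v → Distinct v × Increasing (coverGraph p) v → IsSYT p v
  labelling⇒syt v (distinct , increasing) = distinct , distinct⇒surjective v distinct , rows , columns
    where
    rows : ∀ i j → proj₂ (box p i) ≡ proj₂ (box p j) → proj₁ (box p i) < proj₁ (box p j) → lookup v i Fin.< lookup v j
    rows i j same lt = constant-chain (row p) (row-mono p) (λ a b → lookup v a Fin.< lookup v b) ℕₚ.<-trans
      (λ a b b≡ eq → increasing a b
        (⇒coverGraph (inj₁ (b≡ , row-≡⇒R p _ (step-bound p a b b≡) (trans eq (cong (row p) b≡))))))
      i j (monotone-reflects-< (column p) (column-mono p) (subst₂ _<_ (columnOf i) (columnOf j) lt))
      (trans (sym (rowOf i)) (trans same (rowOf j)))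
    columns : ∀ i j → proj₁ (box p i) ≡ proj₁ (box p j) → proj₂ (box p i) < proj₂ (box p j) → lookup v j Fin.< lookup v i
    columns i j same lt = constant-chain (column p) (column-mono p) (λ a b → lookup v b Fin.< lookup v a) (λ x y → ℕₚ.<-trans y x)
      (λ a b b≡ eq → increasing b a
        (⇒coverGraph (inj₂ (b≡ , column-≡⇒U p _ (step-bound p a b b≡) (trans eq (cong (column p) b≡))))))
      i j (monotone-reflects-< (row p) (row-mono p) (subst₂ _<_ (rowOf i) (rowOf j) lt))
      (trans (sym (columnOf i)) (trans same (columnOf j)))

  syt-count : IsCount (IsSYT p) (extensions (nBoxes p) (coverGraph p))
  syt-count = isCount-image (isLabelling (coverGraph p)) id (IsSYT p) (labellings↔extensions _ _)
    (λ _ _ _ _ eq → eq) (λ v syt → v , ⇒isLabelling (syt⇒labelling v syt) , refl)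
    (λ v ok → labelling⇒syt v (isLabelling⇒ ok))

bitAt : List Bool → ℕ → Bool
bitAt []       k       = false
bitAt (b ∷ bs) zero    = b
bitAt (b ∷ bs) (suc k) = bitAt bs k

height-suc : ∀ bs k → k < length bs → height bs (suc k) ≡ height bs k + boolToℕ (bitAt bs k)
height-suc (true  ∷ bs) zero    _ = refl
height-suc (false ∷ bs) zero    _ = refl
height-suc (true  ∷ bs) (suc k) (s≤s k<) = cong suc (height-suc bs k k<)
height-suc (false ∷ bs) (suc k) (s≤s k<) = height-suc bs k k<

height-char : ∀ bs (H : ℕ → ℕ) → H 0 ≡ 0 → (∀ k → k < length bs → H (suc k) ≡ H k + boolToℕ (bitAt bs k)) →
              ∀ k → k ≤ length bs → height bs k ≡ H k
height-char bs H H0 Hsuc zero    _  = sym H0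
height-char bs H H0 Hsuc (suc k) k< = trans (height-suc bs k k<)
  (trans (cong (_+ boolToℕ (bitAt bs k)) (height-char bs H H0 Hsuc k (ℕₚ.<⇒≤ k<))) (sym (Hsuc k k<)))

height-length : ∀ bs → height bs (length bs) ≡ countTrue bs
height-length bs = cong countTrue (Listₚ.take-all (length bs) bs ℕₚ.≤-refl)

countTrue-++ : ∀ xs ys → countTrue (xs ++ ys) ≡ countTrue xs + countTrue ys
countTrue-++ []           ys = refl
countTrue-++ (true  ∷ xs) ys = cong suc (countTrue-++ xs ys)
countTrue-++ (false ∷ xs) ys = countTrue-++ xs ys

countTrue-map-isU : ∀ p → countTrue (map isU p) ≡ countU p
countTrue-map-isU []      = refl
countTrue-map-isU (R ∷ p) = countTrue-map-isU p
countTrue-map-isU (U ∷ p) = cong suc (countTrue-map-isU p)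

length≡countR+countU : ∀ p → length p ≡ countR p + countU p
length≡countR+countU []      = refl
length≡countR+countU (R ∷ p) = cong suc (length≡countR+countU p)
length≡countR+countU (U ∷ p) = trans (cong suc (length≡countR+countU p)) (sym (ℕₚ.+-suc (countR p) (countU p)))

dOf≡nBoxes : ∀ p → dOf p ≡ nBoxes p
dOf≡nBoxes p = trans (ℕₚ.+-suc (countR p) (countU p)) (cong suc (sym (length≡countR+countU p)))

length-boundaryPath : ∀ p b c → length (b ∷ (map isU p ++ c ∷ [])) ≡ nOf p
length-boundaryPath p b c = cong suc (trans (Listₚ.length-++ (map isU p))
  (trans (cong (_+ 1) (Listₚ.length-map isU p)) (trans (ℕₚ.+-comm (length p) 1) (sym (dOf≡nBoxes p)))))

length-lowerPath : ∀ p → length (lowerPath p) ≡ nOf p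
length-lowerPath p = length-boundaryPath p false true

length-upperPath : ∀ p → length (upperPath p) ≡ nOf p
length-upperPath p = length-boundaryPath p true false

height-lowerPath-end : ∀ p → height (lowerPath p) (nOf p) ≡ rOf p
height-lowerPath-end p = begin
  height (lowerPath p) (nOf p)                ≡⟨ cong (height (lowerPath p)) (sym (length-lowerPath p)) ⟩
  height (lowerPath p) (length (lowerPath p)) ≡⟨ height-length (lowerPath p) ⟩
  countTrue (map isU p ++ true ∷ [])          ≡⟨ countTrue-++ (map isU p) (true ∷ []) ⟩
  countTrue (map isU p) + 1                   ≡⟨ cong (_+ 1) (countTrue-map-isU p) ⟩
  countU p + 1                                ≡⟨ ℕₚ.+-comm (countU p) 1 ⟩
  rOf p                                       ∎
  where open ≡-Reasoning

height-upperPath-end : ∀ p → height (upperPath p) (nOf p) ≡ rOf p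
height-upperPath-end p = begin
  height (upperPath p) (nOf p)                ≡⟨ cong (height (upperPath p)) (sym (length-upperPath p)) ⟩
  height (upperPath p) (length (upperPath p)) ≡⟨ height-length (upperPath p) ⟩
  suc (countTrue (map isU p ++ false ∷ []))   ≡⟨ cong suc (countTrue-++ (map isU p) (false ∷ [])) ⟩
  suc (countTrue (map isU p) + 0)             ≡⟨ cong suc (ℕₚ.+-identityʳ _) ⟩
  suc (countTrue (map isU p))                 ≡⟨ cong suc (countTrue-map-isU p) ⟩
  rOf p                                       ∎
  where open ≡-Reasoning

take-++-last : ∀ (xs : List Bool) a b j → j ≤ length xs → take j (xs ++ a ∷ []) ≡ take j (xs ++ b ∷ [])
take-++-last xs       a b zero    _         = refl
take-++-last (x ∷ xs) a b (suc j) (s≤s j≤) = cong (x ∷_) (take-++-last xs a b j j≤)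

height-upperPath : ∀ p j → j ≤ length p → height (upperPath p) (suc j) ≡ suc (height (lowerPath p) (suc j))
height-upperPath p j j≤ =
  cong (suc ∘ countTrue) (take-++-last (map isU p) false true j (subst (j ≤_) (sym (Listₚ.length-map isU p)) j≤))

bitAt-++ : ∀ (xs : List Bool) ys k → k < length xs → bitAt (xs ++ ys) k ≡ bitAt xs k
bitAt-++ (x ∷ xs) ys zero    _         = refl
bitAt-++ (x ∷ xs) ys (suc k) (s≤s k<) = bitAt-++ xs ys k k<

bitAt-map-isU : ∀ p k → k < length p → bitAt (map isU p) k ≡ isU (stepAt p k)
bitAt-map-isU (s ∷ p) zero    _         = refl
bitAt-map-isU (s ∷ p) (suc k) (s≤s k<) = bitAt-map-isU p k k<

bitAt-lowerPath : ∀ p k → k < length p → bitAt (lowerPath p) (suc k) ≡ isU (stepAt p k)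
bitAt-lowerPath p k k< =
  trans (bitAt-++ (map isU p) _ k (subst (k <_) (sym (Listₚ.length-map isU p)) k<)) (bitAt-map-isU p k k<)

bitAt-lowerPath-end : ∀ p → bitAt (lowerPath p) (suc (length p)) ≡ true
bitAt-lowerPath-end p = trans (cong (bitAt (map isU p ++ true ∷ [])) (sym (Listₚ.length-map isU p))) (last (map isU p))
  where
  last : ∀ (xs : List Bool) → bitAt (xs ++ true ∷ []) (length xs) ≡ true
  last []       = refl
  last (x ∷ xs) = last xs

toℚᵘ-/ : ∀ a m → ℚ.toℚᵘ (a / suc m) ℚᵘ.≃ ℚᵘ.mkℚᵘ a m
toℚᵘ-/ a m = ℚₚ.toℚᵘ-fromℚᵘ (ℚᵘ.mkℚᵘ a m)

/-cong : ∀ a b m n → a ℤ.* + suc n ≡ b ℤ.* + suc m → a / suc m ≡ b / suc n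
/-cong a b m n eq = ℚₚ.fromℚᵘ-cong {ℚᵘ.mkℚᵘ a m} {ℚᵘ.mkℚᵘ b n} (ℚᵘ.*≡* eq)

/-+ : ∀ a b m n → a / suc m ℚ.+ b / suc n ≡ (a ℤ.* + suc n ℤ.+ b ℤ.* + suc m) / (suc m * suc n)
/-+ a b m n = ℚₚ.toℚᵘ-injective (ℚᵘₚ.≃-trans (ℚₚ.toℚᵘ-homo-+ (a / suc m) (b / suc n))
  (ℚᵘₚ.≃-trans (ℚᵘₚ.+-cong (toℚᵘ-/ a m) (toℚᵘ-/ b n)) (ℚᵘₚ.≃-sym (toℚᵘ-/ _ _))))

/-+-same : ∀ a b m → a / suc m ℚ.+ b / suc m ≡ (a ℤ.+ b) / suc m
/-+-same a b m = trans (/-+ a b m m) (/-cong (a ℤ.* + suc m ℤ.+ b ℤ.* + suc m) (a ℤ.+ b) (m + m * suc m) m (begin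
  (a ℤ.* + suc m ℤ.+ b ℤ.* + suc m) ℤ.* + suc m ≡⟨ solve 3 (λ a b N → (a :* N :+ b :* N) :* N := (a :+ b) :* (N :* N))
                                                       refl a b (+ suc m) ⟩
  (a ℤ.+ b) ℤ.* (+ suc m ℤ.* + suc m)           ≡⟨ cong ((a ℤ.+ b) ℤ.*_) (sym (ℤₚ.pos-* (suc m) (suc m))) ⟩
  (a ℤ.+ b) ℤ.* + (suc m * suc m)               ∎))
  where
  open ≡-Reasoning
  open ℤ-Solver

-‿/ : ∀ a m → ℚ.- (a / suc m) ≡ (ℤ.- a) / suc m
-‿/ a m = ℚₚ.toℚᵘ-injective (ℚᵘₚ.≃-trans (ℚₚ.toℚᵘ-homo‿- (a / suc m))
  (ℚᵘₚ.≃-trans (ℚᵘₚ.-‿cong (toℚᵘ-/ a m)) (ℚᵘₚ.≃-sym (toℚᵘ-/ _ _))))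

∣/∣ : ∀ a m → ℚ.∣ a / suc m ∣ ≡ (+ ℤ.∣ a ∣) / suc m
∣/∣ a m = ℚₚ.toℚᵘ-injective (ℚᵘₚ.≃-trans (ℚₚ.toℚᵘ-homo-∣-∣ (a / suc m))
  (ℚᵘₚ.≃-trans (ℚᵘₚ.∣-∣-cong (toℚᵘ-/ a m)) (ℚᵘₚ.≃-sym (toℚᵘ-/ _ _))))

/-mono-≤ : ∀ a b m n → a ℤ.* + suc n ℤ.≤ b ℤ.* + suc m → a / suc m ℚ.≤ b / suc n
/-mono-≤ a b m n le = ℚₚ.toℚᵘ-cancel-≤
  (ℚᵘₚ.≤-respʳ-≃ (ℚᵘₚ.≃-sym (toℚᵘ-/ b n)) (ℚᵘₚ.≤-respˡ-≃ (ℚᵘₚ.≃-sym (toℚᵘ-/ a m)) (ℚᵘ.*≤* le)))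

/-cancel-≤ : ∀ a b m n → a / suc m ℚ.≤ b / suc n → a ℤ.* + suc n ℤ.≤ b ℤ.* + suc m
/-cancel-≤ a b m n le with ℚᵘₚ.≤-respʳ-≃ (toℚᵘ-/ b n) (ℚᵘₚ.≤-respˡ-≃ (toℚᵘ-/ a m) (ℚₚ.toℚᵘ-mono-≤ le))
... | ℚᵘ.*≤* le′ = le′

/-mono-< : ∀ a b m n → a ℤ.* + suc n ℤ.< b ℤ.* + suc m → a / suc m ℚ.< b / suc n
/-mono-< a b m n lt = ℚₚ.toℚᵘ-cancel-<
  (ℚᵘₚ.<-respʳ-≃ (ℚᵘₚ.≃-sym (toℚᵘ-/ b n)) (ℚᵘₚ.<-respˡ-≃ (ℚᵘₚ.≃-sym (toℚᵘ-/ a m)) (ℚᵘ.*<* lt)))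

-- Grid points of the projected polytope

valueAt : ∀ {M m} → Vec (Fin M) m → ℕ → ℕ
valueAt []       k       = 0
valueAt (x ∷ xs) zero    = toℕ x
valueAt (x ∷ xs) (suc k) = valueAt xs k

valueAt-lookup : ∀ {M m} (y : Vec (Fin M) m) i → valueAt y (toℕ i) ≡ toℕ (lookup y i)
valueAt-lookup (x ∷ xs) zero    = refl
valueAt-lookup (x ∷ xs) (suc i) = valueAt-lookup xs i

valueAt-beyond : ∀ {M m} (y : Vec (Fin M) m) k → m ≤ k → valueAt y k ≡ 0
valueAt-beyond []       k       _        = refl
valueAt-beyond (x ∷ xs) (suc k) (s≤s m≤) = valueAt-beyond xs k m≤

valueAt-≤ : ∀ {N m} (y : Vec (Fin (suc N)) m) k → valueAt y k ≤ N
valueAt-≤ []       k       = z≤n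
valueAt-≤ (x ∷ xs) zero    = ℕₚ.≤-pred (Finₚ.toℕ<n x)
valueAt-≤ (x ∷ xs) (suc k) = valueAt-≤ xs k

bitAt-tabulate : ∀ {n} (g : ℕ → Bool) k → k < n → bitAt (Vec.toList (Vec.tabulate {n = n} (g ∘ toℕ))) k ≡ g k
bitAt-tabulate {suc n} g zero    _        = refl
bitAt-tabulate {suc n} g (suc k) (s≤s k<) = bitAt-tabulate {n} (g ∘ suc) k k<

levels : ℕ → List ℕ
levels zero    = []
levels (suc N) = suc N ∷ levels N

length-levels : ∀ N → length (levels N) ≡ N
length-levels zero    = refl
length-levels (suc N) = cong suc (length-levels N)

countOf : List ℕ → (ℕ → Bool) → ℕ
countOf []      f = 0
countOf (c ∷ l) f = boolToℕ (f c) + countOf l f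

countOf-cong : ∀ l {f g : ℕ → Bool} → (∀ c → f c ≡ g c) → countOf l f ≡ countOf l g
countOf-cong []      eq = refl
countOf-cong (c ∷ l) eq = cong₂ _+_ (cong boolToℕ (eq c)) (countOf-cong l eq)

countOf-levels : ∀ N Y → countOf (levels N) (λ c → ⌊ c ℕₚ.≤? Y ⌋) ≡ N ⊓ Y
countOf-levels zero    Y = refl
countOf-levels (suc N) Y with suc N ℕₚ.≤? Y
... | yes N<Y = trans (cong suc (trans (countOf-levels N Y) (ℕₚ.m≤n⇒m⊓n≡m (ℕₚ.<⇒≤ N<Y))))
                      (sym (ℕₚ.m≤n⇒m⊓n≡m N<Y))
... | no  N≮Y = trans (countOf-levels N Y) (trans (ℕₚ.m≥n⇒m⊓n≡n Y≤N) (sym (ℕₚ.m≥n⇒m⊓n≡n (ℕₚ.m≤n⇒m≤1+n Y≤N))))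
  where Y≤N = ℕₚ.≤-pred (ℕₚ.≰⇒> N≮Y)

countOf-levels-≤ : ∀ N Y → Y ≤ N → countOf (levels N) (λ c → ⌊ c ℕₚ.≤? Y ⌋) ≡ Y
countOf-levels-≤ N Y Y≤N = trans (countOf-levels N Y) (ℕₚ.m≥n⇒m⊓n≡n Y≤N)

countOf-xor : ∀ l (f g : ℕ → Bool) → (∀ c → T (f c) → T (g c)) → countOf l (λ c → g c xor f c) + countOf l f ≡ countOf l g
countOf-xor []      f g f⇒g = refl
countOf-xor (c ∷ l) f g f⇒g = trans (+-interchangeℕ (boolToℕ (g c xor f c)) _ (boolToℕ (f c)) _)
                                     (cong₂ _+_ (pointwise (f c) (g c) (f⇒g c)) (countOf-xor l f g f⇒g))
  where
  pointwise : ∀ a b → (T a → T b) → boolToℕ (b xor a) + boolToℕ a ≡ boolToℕ b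
  pointwise true  true  _ = refl
  pointwise true  false a⇒b = ⊥-elim (a⇒b _)
  pointwise false true  _ = refl
  pointwise false false _ = refl

countOf-not : ∀ l (f : ℕ → Bool) → countOf l (not ∘ f) + countOf l f ≡ length l
countOf-not []      f = refl
countOf-not (c ∷ l) f = trans (+-interchangeℕ (boolToℕ (not (f c))) _ (boolToℕ (f c)) _)
                               (cong₂ _+_ (pointwise (f c)) (countOf-not l f))
  where
  pointwise : ∀ b → boolToℕ (not b) + boolToℕ b ≡ 1
  pointwise true  = refl
  pointwise false = refl

⌊≤?⌋-false : ∀ {c Y} → Y < c → ⌊ c ℕₚ.≤? Y ⌋ ≡ false
⌊≤?⌋-false {c} {Y} Y<c with c ℕₚ.≤? Y
... | yes c≤Y = ⊥-elim (ℕₚ.<⇒≱ Y<c c≤Y)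
... | no  _   = refl

+≡⇒≡-ℤ : ∀ a b c → a + b ≡ c → + a ≡ + c ℤ.- + b
+≡⇒≡-ℤ a b c eq = trans (solve 2 (λ a b → a := (a :+ b) :- b) refl (+ a) (+ b))
                        (cong (ℤ._- + b) (trans (sym (ℤₚ.pos-+ a b)) (cong +_ eq)))
  where open ℤ-Solver

isU≡false⇒R : ∀ {s} → isU s ≡ false → s ≡ R
isU≡false⇒R {R} _ = refl

isU≡true⇒U : ∀ {s} → isU s ≡ true → s ≡ U
isU≡true⇒U {U} _ = refl

xor-step : ∀ a u u′ → (a ≡ false → T u → T u′) → (a ≡ true → T u′ → T u) →
           boolToℕ a + boolToℕ u′ ≡ boolToℕ u + boolToℕ (a xor (u′ xor u))
xor-step false false false _ _ = refl
xor-step false false true  _ _ = refl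
xor-step false true  true  _ _ = refl
xor-step false true  false r _ = ⊥-elim (r refl _)
xor-step true  false false _ _ = refl
xor-step true  true  false _ _ = refl
xor-step true  true  true  _ _ = refl
xor-step true  false true  _ f = ⊥-elim (f refl _)

module GridMap (p : BorderStrip) (t : ℕ) where

  N : ℕ
  N = suc t

  lower : ℕ → ℕ
  lower = height (lowerPath p)

  δ : ℕ → ℕ
  δ k = boolToℕ (bitAt (lowerPath p) k)

  Label : Set
  Label = Vec (Fin (suc N)) (nBoxes p)

  -- profile y k is the label of box k - 1, and 0 before the first and after the last box.
  profile : Label → ℕ → ℕ
  profile y zero    = 0
  profile y (suc k) = valueAt y k

  profile-≤ : ∀ y k → profile y k ≤ N
  profile-≤ y zero    = z≤n
  profile-≤ y (suc k) = valueAt-≤ y k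

  gridEntry : Label → ℕ → ℤ
  gridEntry y k = + profile y (suc k) ℤ.- + profile y k ℤ.+ + (N * δ k)

  gridVector : Label → Vec ℤ (dOf p)
  gridVector y = Vec.tabulate (gridEntry y ∘ toℕ)

  FollowsPath : Label → Set
  FollowsPath y = ∀ k → k < nOf p →
    (bitAt (lowerPath p) k ≡ false → profile y k ≤ profile y (suc k)) ×
    (bitAt (lowerPath p) k ≡ true  → profile y (suc k) ≤ profile y k)

  monotone⇒followsPath : ∀ y → T (isMonotone (coverGraph p) y) → FollowsPath y
  monotone⇒followsPath y mono zero    _  = (λ _ → z≤n) , (λ ())
  monotone⇒followsPath y mono (suc j) j< with j ℕₚ.<? length p
  ... | no j≮ℓ = (λ e → ⊥-elim (true≢false
                   (trans (sym (bitAt-lowerPath-end p)) (subst (λ k → bitAt (lowerPath p) (suc k) ≡ false) j≡ℓ e))))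
               , (λ _ → subst (_≤ valueAt y j) (sym (valueAt-beyond y (suc j) (s≤s (ℕₚ.≤-reflexive (sym j≡ℓ))))) z≤n)
    where
    j≡ℓ : j ≡ length p
    j≡ℓ = ℕₚ.≤-antisym (ℕₚ.≤-pred (ℕₚ.≤-pred (subst (suc j <_) (cong suc (dOf≡nBoxes p)) j<))) (ℕₚ.≮⇒≥ j≮ℓ)
    true≢false : true ≢ false
    true≢false ()
  ... | yes j<ℓ = rises , falls
    where
    a b : Fin (nBoxes p)
    a = fromℕ< (ℕₚ.<-trans j<ℓ (ℕₚ.n<1+n _))
    b = fromℕ< (s≤s j<ℓ)
    a≡ : toℕ a ≡ j
    a≡ = Finₚ.toℕ-fromℕ< _
    b≡ : toℕ b ≡ suc (toℕ a)
    b≡ = trans (Finₚ.toℕ-fromℕ< (s≤s j<ℓ)) (cong suc (sym a≡))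
    profile≡a : profile y (suc j) ≡ toℕ (lookup y a)
    profile≡a = trans (cong (valueAt y) (sym a≡)) (valueAt-lookup y a)
    profile≡b : profile y (suc (suc j)) ≡ toℕ (lookup y b)
    profile≡b = trans (cong (valueAt y) (sym (Finₚ.toℕ-fromℕ< (s≤s j<ℓ)))) (valueAt-lookup y b)
    bit≡ : bitAt (lowerPath p) (suc j) ≡ isU (stepAt p (toℕ a))
    bit≡ = trans (bitAt-lowerPath p j j<ℓ) (cong (isU ∘ stepAt p) (sym a≡))
    rises : bitAt (lowerPath p) (suc j) ≡ false → profile y (suc j) ≤ profile y (suc (suc j))
    rises e = subst₂ _≤_ (sym profile≡a) (sym profile≡b)
      (isMonotone⇒ mono a b (⇒coverGraph (inj₁ (b≡ , isU≡false⇒R (trans (sym bit≡) e)))))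
    falls : bitAt (lowerPath p) (suc j) ≡ true → profile y (suc (suc j)) ≤ profile y (suc j)
    falls e = subst₂ _≤_ (sym profile≡b) (sym profile≡a)
      (isMonotone⇒ mono b a (⇒coverGraph (inj₂ (b≡ , isU≡true⇒U (trans (sym bit≡) e)))))

  -- The basis of level c follows the lower path, raised by one wherever the profile reaches c.
  module Mixture (y : Label) (follows : FollowsPath y) where

    reaches : ℕ → ℕ → Bool
    reaches c k = ⌊ c ℕₚ.≤? profile y k ⌋

    basisBit : ℕ → ℕ → Bool
    basisBit c k = bitAt (lowerPath p) k xor (reaches c (suc k) xor reaches c k)

    basis : ℕ → Vec Bool (nOf p)
    basis c = Vec.tabulate (basisBit c ∘ toℕ)

    reaches-mono : ∀ c {k k′} → profile y k ≤ profile y k′ → T (reaches c k) → T (reaches c k′)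
    reaches-mono c le r = fromWitness (ℕₚ.≤-trans (toWitness r) le)

    reaches-end : ∀ c → 1 ≤ c → reaches c (nOf p) ≡ false
    reaches-end c 1≤c = ⌊≤?⌋-false (subst (_< c) (sym (valueAt-beyond y (dOf p) (ℕₚ.≤-reflexive (sym (dOf≡nBoxes p))))) 1≤c)

    height-basis : ∀ c → 1 ≤ c → ∀ k → k ≤ nOf p → height (Vec.toList (basis c)) k ≡ lower k + boolToℕ (reaches c k)
    height-basis c 1≤c k k≤ = height-char (Vec.toList (basis c)) (λ k → lower k + boolToℕ (reaches c k))
      (cong boolToℕ (⌊≤?⌋-false 1≤c)) step k (subst (k ≤_) (sym (Vecₚ.length-toList (basis c))) k≤)
      where
      step : ∀ k → k < length (Vec.toList (basis c)) →
             lower (suc k) + boolToℕ (reaches c (suc k))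
             ≡ lower k + boolToℕ (reaches c k) + boolToℕ (bitAt (Vec.toList (basis c)) k)
      step k k< = begin
        lower (suc k) + boolToℕ (reaches c (suc k))                   ≡⟨ cong (_+ boolToℕ (reaches c (suc k)))
                                                                           (height-suc (lowerPath p) k k<lp) ⟩
        lower k + δ k + boolToℕ (reaches c (suc k))                   ≡⟨ ℕₚ.+-assoc (lower k) _ _ ⟩
        lower k + (δ k + boolToℕ (reaches c (suc k)))                 ≡⟨ cong (λ v → lower k + v) (xor-step _ _ _
                                                                           (λ e → reaches-mono c {k} {suc k} (proj₁ (follows k k<n) e))
                                                                           (λ e → reaches-mono c {suc k} {k} (proj₂ (follows k k<n) e))) ⟩
        lower k + (boolToℕ (reaches c k) + boolToℕ (basisBit c k))    ≡⟨ sym (ℕₚ.+-assoc (lower k) _ _) ⟩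
        lower k + boolToℕ (reaches c k) + boolToℕ (basisBit c k)      ≡⟨ cong (λ b → lower k + boolToℕ (reaches c k) + boolToℕ b)
                                                                           (sym (bitAt-tabulate (basisBit c) k k<n)) ⟩
        lower k + boolToℕ (reaches c k) + boolToℕ (bitAt (Vec.toList (basis c)) k) ∎
        where
        open ≡-Reasoning
        k<n : k < nOf p
        k<n = subst (k <_) (Vecₚ.length-toList (basis c)) k<
        k<lp : k < length (lowerPath p)
        k<lp = subst (k <_) (sym (length-lowerPath p)) k<n

    basis-isBasis : ∀ c → 1 ≤ c → IsBasis p (basis c)
    basis-isBasis c 1≤c = count , λ k k≤ → lower≤ k k≤ , ≤upper k k≤
      where
      bits = Vec.toList (basis c)
      height-end : height bits (nOf p) ≡ rOf p
      height-end = trans (height-basis c 1≤c (nOf p) ℕₚ.≤-refl)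
        (trans (cong (λ b → lower (nOf p) + boolToℕ b) (reaches-end c 1≤c))
        (trans (ℕₚ.+-identityʳ _) (height-lowerPath-end p)))
      count : countTrue bits ≡ rOf p
      count = trans (sym (height-length bits)) (trans (cong (height bits) (Vecₚ.length-toList (basis c))) height-end)
      lower≤ : ∀ k → k ≤ nOf p → lower k ≤ height bits k
      lower≤ k k≤ = subst (lower k ≤_) (sym (height-basis c 1≤c k k≤)) (ℕₚ.m≤m+n _ _)
      ≤upper : ∀ k → k ≤ nOf p → height bits k ≤ height (upperPath p) k
      ≤upper zero    _  = z≤n
      ≤upper (suc j) j< with j ℕₚ.≤? length p
      ... | yes j≤ℓ = subst₂ _≤_ (sym (height-basis c 1≤c (suc j) j<)) (sym (height-upperPath p j j≤ℓ))
                        (ℕₚ.≤-trans (ℕₚ.+-monoʳ-≤ (lower (suc j)) (boolToℕ≤1 (reaches c (suc j)))) (ℕₚ.≤-reflexive (ℕₚ.+-comm _ 1)))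
        where
        boolToℕ≤1 : ∀ b → boolToℕ b ≤ 1
        boolToℕ≤1 true  = s≤s z≤n
        boolToℕ≤1 false = z≤n
      ... | no  j≰ℓ = subst₂ _≤_ (trans (sym height-end) (cong (height bits) (sym last)))
                                 (trans (sym (height-upperPath-end p)) (cong (height (upperPath p)) (sym last))) ℕₚ.≤-refl
        where
        last : suc j ≡ nOf p
        last = ℕₚ.≤-antisym j< (subst (_≤ suc j) (sym (cong suc (dOf≡nBoxes p))) (s≤s (ℕₚ.≰⇒> j≰ℓ)))

    countOf-basisBit : ∀ k → k < nOf p → + countOf (levels N) (λ c → basisBit c k) ≡ gridEntry y k
    countOf-basisBit k k< with bitAt (lowerPath p) k | follows k k<
    ... | false | (rises , _) =
      trans (+≡⇒≡-ℤ (countOf (levels N) crossed) (profile y k) (profile y (suc k)) crossings)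
            (trans (sym (ℤₚ.+-identityʳ _)) (cong (λ v → + profile y (suc k) ℤ.- + profile y k ℤ.+ + v) (sym (ℕₚ.*-zeroʳ N))))
      where
      crossed : ℕ → Bool
      crossed c = reaches c (suc k) xor reaches c k
      crossings : countOf (levels N) crossed + profile y k ≡ profile y (suc k)
      crossings = begin
        countOf (levels N) crossed + profile y k
          ≡⟨ cong (λ v → countOf (levels N) crossed + v) (sym (countOf-levels-≤ N (profile y k) (profile-≤ y k))) ⟩
        countOf (levels N) crossed + countOf (levels N) (λ c → reaches c k)
          ≡⟨ countOf-xor (levels N) (λ c → reaches c k) (λ c → reaches c (suc k)) (λ c → reaches-mono c {k} {suc k} (rises refl)) ⟩
        countOf (levels N) (λ c → reaches c (suc k))
          ≡⟨ countOf-levels-≤ N (profile y (suc k)) (profile-≤ y (suc k)) ⟩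
        profile y (suc k) ∎
        where open ≡-Reasoning
    ... | true | (_ , falls) =
      trans (+≡⇒≡-ℤ (countOf (levels N) (not ∘ crossed)) (countOf (levels N) crossed) N uncrossed)
            (trans (cong (λ v → + N ℤ.- v) (+≡⇒≡-ℤ (countOf (levels N) crossed) (profile y (suc k)) (profile y k) crossings)) rearrange)
      where
      crossed : ℕ → Bool
      crossed c = reaches c (suc k) xor reaches c k
      crossings : countOf (levels N) crossed + profile y (suc k) ≡ profile y k
      crossings = begin
        countOf (levels N) crossed + profile y (suc k)
          ≡⟨ cong₂ _+_ (countOf-cong (levels N) λ c → xor-comm (reaches c (suc k)) (reaches c k))
                       (sym (countOf-levels-≤ N (profile y (suc k)) (profile-≤ y (suc k)))) ⟩
        countOf (levels N) (λ c → reaches c k xor reaches c (suc k)) + countOf (levels N) (λ c → reaches c (suc k))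
          ≡⟨ countOf-xor (levels N) (λ c → reaches c (suc k)) (λ c → reaches c k) (λ c → reaches-mono c {suc k} {k} (falls refl)) ⟩
        countOf (levels N) (λ c → reaches c k)
          ≡⟨ countOf-levels-≤ N (profile y k) (profile-≤ y k) ⟩
        profile y k ∎
        where open ≡-Reasoning
      uncrossed : countOf (levels N) (not ∘ crossed) + countOf (levels N) crossed ≡ N
      uncrossed = trans (countOf-not (levels N) crossed) (length-levels N)
      rearrange : + N ℤ.- (+ profile y k ℤ.- + profile y (suc k)) ≡ + profile y (suc k) ℤ.- + profile y k ℤ.+ + (N * 1)
      rearrange = trans (solve 3 (λ n a b → n :- (a :- b) := b :- a :+ n) refl (+ N) (+ profile y k) (+ profile y (suc k)))
                        (cong (λ v → + profile y (suc k) ℤ.- + profile y k ℤ.+ + v) (sym (ℕₚ.*-identityʳ N)))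
        where open ℤ-Solver

    weight : ℚ
    weight = + 1 / N

    mixtureUpTo : ℕ → ConvComb p
    mixtureUpTo M = List.map (λ c → basis c , weight) (levels M)

    0≡0/N : 0ℚ ≡ + 0 / N
    0≡0/N = /-cong (+ 0) (+ 0) 0 t refl

    combCoord-mixtureUpTo : ∀ M i → combCoord p (mixtureUpTo M) i ≡ + countOf (levels M) (λ c → basisBit c (toℕ i)) / N
    combCoord-mixtureUpTo zero    i = 0≡0/N
    combCoord-mixtureUpTo (suc M) i = begin
      (if lookup (basis (suc M)) i then weight else 0ℚ) ℚ.+ combCoord p (mixtureUpTo M) i
        ≡⟨ cong₂ ℚ._+_ (trans (cong (λ b → if b then weight else 0ℚ) (Vecₚ.lookup∘tabulate (basisBit (suc M) ∘ toℕ) i))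
                              (selected (basisBit (suc M) (toℕ i))))
                       (combCoord-mixtureUpTo M i) ⟩
      + boolToℕ (basisBit (suc M) (toℕ i)) / N ℚ.+ + countOf (levels M) (λ c → basisBit c (toℕ i)) / N
        ≡⟨ /-+-same (+ boolToℕ (basisBit (suc M) (toℕ i))) (+ countOf (levels M) (λ c → basisBit c (toℕ i))) t ⟩
      (+ boolToℕ (basisBit (suc M) (toℕ i)) ℤ.+ + countOf (levels M) (λ c → basisBit c (toℕ i))) / N
        ≡⟨ cong (_/ N) (sym (ℤₚ.pos-+ (boolToℕ (basisBit (suc M) (toℕ i))) _)) ⟩
      + countOf (levels (suc M)) (λ c → basisBit c (toℕ i)) / N ∎
      where
      open ≡-Reasoning
      selected : ∀ b → (if b then weight else 0ℚ) ≡ + boolToℕ b / N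
      selected true  = refl
      selected false = 0≡0/N

    weights-mixtureUpTo : ∀ M → sumℚ (List.map proj₂ (mixtureUpTo M)) ≡ + M / N
    weights-mixtureUpTo zero    = 0≡0/N
    weights-mixtureUpTo (suc M) =
      trans (cong (weight ℚ.+_) (weights-mixtureUpTo M)) (trans (/-+-same (+ 1) (+ M) t) (cong (_/ N) (sym (ℤₚ.pos-+ 1 M))))

    mixtureUpTo-valid : ∀ M → All (λ bw → IsBasis p (proj₁ bw) × (0ℚ ℚ.≤ proj₂ bw)) (mixtureUpTo M)
    mixtureUpTo-valid zero    = []
    mixtureUpTo-valid (suc M) = (basis-isBasis (suc M) (s≤s z≤n) , /-mono-≤ (+ 0) (+ 1) 0 t (ℤ.+≤+ z≤n)) ∷ mixtureUpTo-valid M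

    gridVector-gridPoint : GridPoint p t (gridVector y)
    gridVector-gridPoint = Vec.tabulate (combCoord p (mixtureUpTo N)) ,
      (mixtureUpTo N , (mixtureUpTo-valid N , total) , λ i → sym (Vecₚ.lookup∘tabulate (combCoord p (mixtureUpTo N)) i)) , projection
      where
      total : sumℚ (List.map proj₂ (mixtureUpTo N)) ≡ 1ℚ
      total = trans (weights-mixtureUpTo N) (/-cong (+ N) (+ 1) t 0 (ℤₚ.*-comm (+ N) (+ 1)))
      projection : ∀ i → lookup (Vec.tabulate (combCoord p (mixtureUpTo N))) (inject₁ i)
                       ≡ lookup (Vec.map (λ zᵢ → zᵢ / suc t) (gridVector y)) i
      projection i = begin
        lookup (Vec.tabulate (combCoord p (mixtureUpTo N))) (inject₁ i)
          ≡⟨ Vecₚ.lookup∘tabulate (combCoord p (mixtureUpTo N)) (inject₁ i) ⟩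
        combCoord p (mixtureUpTo N) (inject₁ i)
          ≡⟨ combCoord-mixtureUpTo N (inject₁ i) ⟩
        + countOf (levels N) (λ c → basisBit c (toℕ (inject₁ i))) / N
          ≡⟨ cong (λ k → + countOf (levels N) (λ c → basisBit c k) / N) (Finₚ.toℕ-inject₁ i) ⟩
        + countOf (levels N) (λ c → basisBit c (toℕ i)) / N
          ≡⟨ cong (_/ N) (countOf-basisBit (toℕ i) (ℕₚ.<-trans (Finₚ.toℕ<n i) (ℕₚ.n<1+n _))) ⟩
        gridEntry y (toℕ i) / N
          ≡⟨ sym (trans (Vecₚ.lookup-map i (λ zᵢ → zᵢ / suc t) (gridVector y))
                        (cong (_/ suc t) (Vecₚ.lookup∘tabulate (gridEntry y ∘ toℕ) i))) ⟩
        lookup (Vec.map (λ zᵢ → zᵢ / suc t) (gridVector y)) i ∎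
        where open ≡-Reasoning

prefixSum : ∀ {n} → (Fin n → ℚ) → ℕ → ℚ
prefixSum {zero}  f k       = 0ℚ
prefixSum {suc n} f zero    = 0ℚ
prefixSum {suc n} f (suc k) = f zero ℚ.+ prefixSum (f ∘ suc) k

prefixSum-cong : ∀ {n} {f g : Fin n → ℚ} → (∀ i → f i ≡ g i) → ∀ k → prefixSum f k ≡ prefixSum g k
prefixSum-cong {zero}  eq k       = refl
prefixSum-cong {suc n} eq zero    = refl
prefixSum-cong {suc n} eq (suc k) = cong₂ ℚ._+_ (eq zero) (prefixSum-cong (eq ∘ suc) k)

prefixSum-0 : ∀ {n} k → prefixSum {n} (λ _ → 0ℚ) k ≡ 0ℚ
prefixSum-0 {zero}  k       = refl
prefixSum-0 {suc n} zero    = refl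
prefixSum-0 {suc n} (suc k) = cong (0ℚ ℚ.+_) (prefixSum-0 {n} k)

prefixSum-+ : ∀ {n} (f g : Fin n → ℚ) k → prefixSum (λ i → f i ℚ.+ g i) k ≡ prefixSum f k ℚ.+ prefixSum g k
prefixSum-+ {zero}  f g k       = sym (ℚₚ.+-identityˡ 0ℚ)
prefixSum-+ {suc n} f g zero    = sym (ℚₚ.+-identityˡ 0ℚ)
prefixSum-+ {suc n} f g (suc k) = trans (cong ((f zero ℚ.+ g zero) ℚ.+_) (prefixSum-+ (f ∘ suc) (g ∘ suc) k))
  (+-interchangeℚ (f zero) (g zero) (prefixSum (f ∘ suc) k) (prefixSum (g ∘ suc) k))

prefixSum-inject₁ : ∀ {m} (f : Fin (suc m) → ℚ) k → k ≤ m → prefixSum f k ≡ prefixSum (f ∘ inject₁) k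
prefixSum-inject₁ {zero}  f zero    _        = refl
prefixSum-inject₁ {suc m} f zero    _        = refl
prefixSum-inject₁ {suc m} f (suc k) (s≤s k≤) = cong (f zero ℚ.+_) (prefixSum-inject₁ (f ∘ suc) k k≤)

prefixSumℤ : ∀ {m} → Vec ℤ m → ℕ → ℤ
prefixSumℤ zs       zero    = + 0
prefixSumℤ []       (suc k) = + 0
prefixSumℤ (z ∷ zs) (suc k) = z ℤ.+ prefixSumℤ zs k

prefixSumℤ-suc : ∀ {m} (zs : Vec ℤ m) k (k< : k < m) → prefixSumℤ zs (suc k) ≡ prefixSumℤ zs k ℤ.+ lookup zs (fromℕ< k<)
prefixSumℤ-suc (z ∷ zs) zero    _        = trans (ℤₚ.+-identityʳ z) (sym (ℤₚ.+-identityˡ z))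
prefixSumℤ-suc (z ∷ zs) (suc k) (s≤s k<) = trans (cong (λ v → z ℤ.+ v) (prefixSumℤ-suc zs k k<)) (sym (ℤₚ.+-assoc z _ _))

prefixSum-/ : ∀ {m} (zs : Vec ℤ m) t k → prefixSum (λ i → lookup zs i / suc t) k ≡ prefixSumℤ zs k / suc t
prefixSum-/ []       t zero    = /-cong (+ 0) (+ 0) 0 t refl
prefixSum-/ []       t (suc k) = /-cong (+ 0) (+ 0) 0 t refl
prefixSum-/ (z ∷ zs) t zero    = /-cong (+ 0) (+ 0) 0 t refl
prefixSum-/ (z ∷ zs) t (suc k) = trans (cong (z / suc t ℚ.+_) (prefixSum-/ zs t k)) (/-+-same z (prefixSumℤ zs k) t)

ℕ→ℚ : ℕ → ℚ
ℕ→ℚ a = + a / 1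

ℕ→ℚ-+ : ∀ a b → ℕ→ℚ (a + b) ≡ ℕ→ℚ a ℚ.+ ℕ→ℚ b
ℕ→ℚ-+ a b = sym (trans (/-+-same (+ a) (+ b) 0) (cong (_/ 1) (sym (ℤₚ.pos-+ a b))))

ℕ→ℚ-mono-≤ : ∀ {a b} → a ≤ b → ℕ→ℚ a ℚ.≤ ℕ→ℚ b
ℕ→ℚ-mono-≤ {a} {b} a≤b = /-mono-≤ (+ a) (+ b) 0 0 (ℤₚ.*-monoʳ-≤-nonNeg (+ 1) (ℤ.+≤+ a≤b))

prefixSum-select : ∀ {n} (B : Vec Bool n) (w : ℚ) k →
  prefixSum (λ i → if lookup B i then w else 0ℚ) k ≡ ℕ→ℚ (height (Vec.toList B) k) ℚ.* w
prefixSum-select []      w zero    = sym (ℚₚ.*-zeroˡ w)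
prefixSum-select []      w (suc k) = sym (ℚₚ.*-zeroˡ w)
prefixSum-select (b ∷ B) w zero    = sym (ℚₚ.*-zeroˡ w)
prefixSum-select (b ∷ B) w (suc k) = begin
  (if b then w else 0ℚ) ℚ.+ prefixSum (λ i → if lookup B i then w else 0ℚ) k
    ≡⟨ cong₂ ℚ._+_ (selected b) (prefixSum-select B w k) ⟩
  ℕ→ℚ (boolToℕ b) ℚ.* w ℚ.+ ℕ→ℚ (height (Vec.toList B) k) ℚ.* w
    ≡⟨ sym (ℚₚ.*-distribʳ-+ w (ℕ→ℚ (boolToℕ b)) _) ⟩
  (ℕ→ℚ (boolToℕ b) ℚ.+ ℕ→ℚ (height (Vec.toList B) k)) ℚ.* w
    ≡⟨ cong (ℚ._* w) (trans (sym (ℕ→ℚ-+ (boolToℕ b) _)) (cong ℕ→ℚ (height-cons b))) ⟩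
  ℕ→ℚ (height (Vec.toList (b ∷ B)) (suc k)) ℚ.* w ∎
  where
  open ≡-Reasoning
  selected : ∀ b → (if b then w else 0ℚ) ≡ ℕ→ℚ (boolToℕ b) ℚ.* w
  selected true  = sym (ℚₚ.*-identityˡ w)
  selected false = sym (ℚₚ.*-zeroˡ w)
  height-cons : ∀ b → boolToℕ b + height (Vec.toList B) k ≡ height (Vec.toList (b ∷ B)) (suc k)
  height-cons true  = refl
  height-cons false = refl

heightSum : ∀ {n} → List (Vec Bool n × ℚ) → ℕ → ℚ
heightSum []            k = 0ℚ
heightSum ((B , w) ∷ L) k = ℕ→ℚ (height (Vec.toList B) k) ℚ.* w ℚ.+ heightSum L k

prefixSum-combCoord : ∀ p (L : ConvComb p) k → prefixSum (combCoord p L) k ≡ heightSum L k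
prefixSum-combCoord p []            k = prefixSum-0 {nOf p} k
prefixSum-combCoord p ((B , w) ∷ L) k =
  trans (prefixSum-+ (λ i → if lookup B i then w else 0ℚ) (combCoord p L) k)
        (cong₂ ℚ._+_ (prefixSum-select B w k) (prefixSum-combCoord p L k))

heightSum-bounds : ∀ {n} (L : List (Vec Bool n × ℚ)) k lo hi →
  All (λ bw → (lo ≤ height (Vec.toList (proj₁ bw)) k) × (height (Vec.toList (proj₁ bw)) k ≤ hi) × (0ℚ ℚ.≤ proj₂ bw)) L →
  (ℕ→ℚ lo ℚ.* sumℚ (List.map proj₂ L) ℚ.≤ heightSum L k) × (heightSum L k ℚ.≤ ℕ→ℚ hi ℚ.* sumℚ (List.map proj₂ L))
heightSum-bounds []            k lo hi [] =
  ℚₚ.≤-reflexive (ℚₚ.*-zeroʳ (ℕ→ℚ lo)) , ℚₚ.≤-reflexive (sym (ℚₚ.*-zeroʳ (ℕ→ℚ hi)))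
heightSum-bounds ((B , w) ∷ L) k lo hi ((lo≤ , ≤hi , 0≤w) ∷ rest) =
  ℚₚ.≤-trans (ℚₚ.≤-reflexive (ℚₚ.*-distribˡ-+ (ℕ→ℚ lo) w _))
             (ℚₚ.+-mono-≤ (ℚₚ.*-monoʳ-≤-nonNeg w {{w≥0}} (ℕ→ℚ-mono-≤ lo≤)) (proj₁ IH)) ,
  ℚₚ.≤-trans (ℚₚ.+-mono-≤ (ℚₚ.*-monoʳ-≤-nonNeg w {{w≥0}} (ℕ→ℚ-mono-≤ ≤hi)) (proj₂ IH))
             (ℚₚ.≤-reflexive (sym (ℚₚ.*-distribˡ-+ (ℕ→ℚ hi) w _)))
  where
  IH = heightSum-bounds L k lo hi rest
  w≥0 = ℚ.nonNegative 0≤w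

combCoord-bounds : ∀ p (L : ConvComb p) → All (λ bw → IsBasis p (proj₁ bw) × (0ℚ ℚ.≤ proj₂ bw)) L → ∀ i →
  (0ℚ ℚ.≤ combCoord p L i) × (combCoord p L i ℚ.≤ sumℚ (List.map proj₂ L))
combCoord-bounds p []            []                 i = ℚₚ.≤-refl , ℚₚ.≤-refl
combCoord-bounds p ((B , w) ∷ L) ((_ , 0≤w) ∷ rest) i =
  ℚₚ.≤-trans (ℚₚ.≤-reflexive (sym (ℚₚ.+-identityˡ 0ℚ))) (ℚₚ.+-mono-≤ (0≤selected (lookup B i)) (proj₁ IH)) ,
  ℚₚ.+-mono-≤ (selected≤w (lookup B i)) (proj₂ IH)
  where
  IH = combCoord-bounds p L rest i
  0≤selected : ∀ b → 0ℚ ℚ.≤ (if b then w else 0ℚ)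
  0≤selected true  = 0≤w
  0≤selected false = ℚₚ.≤-refl
  selected≤w : ∀ b → (if b then w else 0ℚ) ℚ.≤ w
  selected≤w true  = ℚₚ.≤-refl
  selected≤w false = 0≤w

-- Along an E step of the lower path the grid entry is the rise of the profile, along an N step it is N plus the rise.
step-rises : ∀ a b (z : ℤ) c → c ≡ 0 → + b ≡ + a ℤ.+ (z ℤ.- + c) → + 0 ℤ.≤ z → a ≤ b
step-rises a b z c c≡0 b≡ 0≤z = ℤₚ.drop‿+≤+ (begin
  + a               ≡⟨ sym (ℤₚ.+-identityʳ (+ a)) ⟩
  + a ℤ.+ + 0       ≤⟨ ℤₚ.+-monoʳ-≤ (+ a) 0≤z ⟩
  + a ℤ.+ z         ≡⟨ cong (λ v → + a ℤ.+ v) (sym (trans (cong (λ v → z ℤ.- + v) c≡0) (ℤₚ.+-identityʳ z))) ⟩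
  + a ℤ.+ (z ℤ.- + c) ≡⟨ sym b≡ ⟩
  + b               ∎)
  where open ℤₚ.≤-Reasoning

step-falls : ∀ a b (z : ℤ) c N → c ≡ N → + b ≡ + a ℤ.+ (z ℤ.- + c) → z ℤ.≤ + N → b ≤ a
step-falls a b z c N c≡N b≡ z≤N = ℤₚ.drop‿+≤+ (begin
  + b                 ≡⟨ b≡ ⟩
  + a ℤ.+ (z ℤ.- + c) ≤⟨ ℤₚ.+-monoʳ-≤ (+ a) (subst (λ v → z ℤ.- + v ℤ.≤ + 0) (sym c≡N) (ℤₚ.i≤j⇒i-j≤0 z≤N)) ⟩
  + a ℤ.+ + 0         ≡⟨ ℤₚ.+-identityʳ (+ a) ⟩
  + a                 ∎)
  where open ℤₚ.≤-Reasoning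

≤-+⇒-≤ : ∀ {a b c} → a ℤ.≤ b ℤ.+ c → a ℤ.- b ℤ.≤ c
≤-+⇒-≤ {a} {b} {c} le = subst (a ℤ.- b ℤ.≤_) (solve 2 (λ b c → b :+ c :- b := c) refl b c) (ℤₚ.+-monoˡ-≤ (ℤ.- b) le)
  where open ℤ-Solver

module GridInverse (p : BorderStrip) (t : ℕ) where

  open GridMap p t

  gridVector-lookup : ∀ y k (k< : k < dOf p) → lookup (gridVector y) (fromℕ< k<) ≡ gridEntry y k
  gridVector-lookup y k k< =
    trans (Vecₚ.lookup∘tabulate (gridEntry y ∘ toℕ) (fromℕ< k<)) (cong (gridEntry y) (Finₚ.toℕ-fromℕ< k<))

  profile-determined : ∀ y y′ → gridVector y ≡ gridVector y′ → ∀ k → k ≤ dOf p → profile y k ≡ profile y′ k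
  profile-determined y y′ eq zero    _  = refl
  profile-determined y y′ eq (suc k) k< = cong ℤ.∣_∣ (begin
    + profile y (suc k)                                        ≡⟨ recover (+ profile y (suc k)) (+ profile y k) ⟩
    gridEntry y k ℤ.- + (N * δ k) ℤ.+ + profile y k            ≡⟨ cong₂ (λ a b → a ℤ.- + (N * δ k) ℤ.+ b) entries (cong +_ IH) ⟩
    gridEntry y′ k ℤ.- + (N * δ k) ℤ.+ + profile y′ k          ≡⟨ sym (recover (+ profile y′ (suc k)) (+ profile y′ k)) ⟩
    + profile y′ (suc k)                                       ∎)
    where
    open ≡-Reasoning
    recover : ∀ a b → a ≡ (a ℤ.- b ℤ.+ + (N * δ k)) ℤ.- + (N * δ k) ℤ.+ b
    recover a b = solve 3 (λ a b c → a := (a :- b :+ c) :- c :+ b) refl a b (+ (N * δ k))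
      where open ℤ-Solver
    IH = profile-determined y y′ eq k (ℕₚ.<⇒≤ k<)
    entries : gridEntry y k ≡ gridEntry y′ k
    entries = trans (sym (gridVector-lookup y k k<)) (trans (cong (λ v → lookup v (fromℕ< k<)) eq) (gridVector-lookup y′ k k<))

  gridVector-injective : ∀ y y′ → gridVector y ≡ gridVector y′ → y ≡ y′
  gridVector-injective y y′ eq = ≡-lookup λ i → Finₚ.toℕ-injective
    (trans (sym (valueAt-lookup y i)) (trans (profile-determined y y′ eq (suc (toℕ i)) (i< i)) (valueAt-lookup y′ i)))
    where
    i< : ∀ (i : Fin (nBoxes p)) → suc (toℕ i) ≤ dOf p
    i< i = subst (suc (toℕ i) ≤_) (sym (dOf≡nBoxes p)) (Finₚ.toℕ<n i)

  module FromGridPoint (z : Vec ℤ (dOf p)) (x : Vec ℚ (nOf p)) (comb : ConvComb p)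
    (valid : All (λ bw → IsBasis p (proj₁ bw) × (0ℚ ℚ.≤ proj₂ bw)) comb) (total : sumℚ (List.map proj₂ comb) ≡ 1ℚ)
    (coords : ∀ i → combCoord p comb i ≡ lookup x i)
    (projection : ∀ i → lookup x (inject₁ i) ≡ lookup (Vec.map (λ zᵢ → zᵢ / suc t) z) i) where

    coord≡ : ∀ i → combCoord p comb (inject₁ i) ≡ lookup z i / N
    coord≡ i = trans (coords (inject₁ i)) (trans (projection i) (Vecₚ.lookup-map i (λ zᵢ → zᵢ / suc t) z))

    z-bounds : ∀ i → (+ 0 ℤ.≤ lookup z i) × (lookup z i ℤ.≤ + N)
    z-bounds i =
      subst (+ 0 ℤ.≤_) (ℤₚ.*-identityʳ (lookup z i))
            (/-cancel-≤ (+ 0) (lookup z i) 0 t (subst (0ℚ ℚ.≤_) (coord≡ i) (proj₁ bounds))) ,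
      subst₂ ℤ._≤_ (ℤₚ.*-identityʳ (lookup z i)) (ℤₚ.*-identityˡ (+ N))
            (/-cancel-≤ (lookup z i) (+ 1) t 0 (subst₂ ℚ._≤_ (coord≡ i) total (proj₂ bounds)))
      where bounds = combCoord-bounds p comb valid (inject₁ i)

    S : ℕ → ℤ
    S = prefixSumℤ z

    prefixSum-coords : ∀ k → k ≤ dOf p → prefixSum (combCoord p comb) k ≡ S k / N
    prefixSum-coords k k≤ = begin
      prefixSum (combCoord p comb) k               ≡⟨ prefixSum-cong coords k ⟩
      prefixSum (lookup x) k                       ≡⟨ prefixSum-inject₁ (lookup x) k k≤ ⟩
      prefixSum (lookup x ∘ inject₁) k             ≡⟨ prefixSum-cong (λ i → trans (projection i) (Vecₚ.lookup-map i _ z)) k ⟩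
      prefixSum (λ i → lookup z i / suc t) k       ≡⟨ prefixSum-/ z t k ⟩
      S k / N                                      ∎
      where open ≡-Reasoning

    S-bounds : ∀ j → j ≤ length p → (+ lower (suc j) ℤ.* + N ℤ.≤ S (suc j)) × (S (suc j) ℤ.≤ + suc (lower (suc j)) ℤ.* + N)
    S-bounds j j≤ =
      subst (+ lower k ℤ.* + N ℤ.≤_) (ℤₚ.*-identityʳ _) (/-cancel-≤ (+ lower k) (S k) 0 t from-below) ,
      subst (ℤ._≤ + suc (lower k) ℤ.* + N) (ℤₚ.*-identityʳ _) (/-cancel-≤ (S k) (+ suc (lower k)) t 0 from-above)
      where
      k = suc j
      k≤d : k ≤ dOf p
      k≤d = subst (k ≤_) (sym (dOf≡nBoxes p)) (s≤s j≤)
      k≤n : k ≤ nOf p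
      k≤n = ℕₚ.≤-trans k≤d (ℕₚ.n≤1+n _)
      heights = heightSum-bounds comb k (lower k) (height (upperPath p) k)
        (All.map (λ (isBasis , 0≤w) → proj₁ (proj₂ isBasis k k≤n) , proj₂ (proj₂ isBasis k k≤n) , 0≤w) valid)
      heightSum≡ : heightSum comb k ≡ S k / N
      heightSum≡ = trans (sym (prefixSum-combCoord p comb k)) (prefixSum-coords k k≤d)
      from-below : ℕ→ℚ (lower k) ℚ.≤ S k / N
      from-below = subst₂ ℚ._≤_ (trans (cong (ℕ→ℚ (lower k) ℚ.*_) total) (ℚₚ.*-identityʳ _)) heightSum≡ (proj₁ heights)
      from-above : S k / N ℚ.≤ ℕ→ℚ (suc (lower k))
      from-above = subst₂ ℚ._≤_ heightSum≡
        (trans (cong (ℕ→ℚ (height (upperPath p) k) ℚ.*_) total) (trans (ℚₚ.*-identityʳ _) (cong ℕ→ℚ (height-upperPath p j j≤))))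
        (proj₂ heights)

    level : ℕ → ℤ
    level k = S k ℤ.- + (N * lower k)

    level-bounds : ∀ j → j ≤ length p → (+ 0 ℤ.≤ level (suc j)) × (level (suc j) ℤ.≤ + N)
    level-bounds j j≤ =
      subst (λ c → + 0 ℤ.≤ S (suc j) ℤ.- c) (sym N*lower) (ℤₚ.i≤j⇒0≤j-i (proj₁ (S-bounds j j≤))) ,
      ≤-+⇒-≤ (subst (S (suc j) ℤ.≤_) upper (proj₂ (S-bounds j j≤)))
      where
      L = lower (suc j)
      N*lower : + (N * L) ≡ + L ℤ.* + N
      N*lower = trans (ℤₚ.pos-* N L) (ℤₚ.*-comm (+ N) (+ L))
      upper : + suc L ℤ.* + N ≡ + (N * L) ℤ.+ + N
      upper = trans (sym (ℤₚ.pos-* (suc L) N))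
        (trans (cong +_ (trans (ℕₚ.+-comm N (L * N)) (cong (_+ N) (ℕₚ.*-comm L N)))) (ℤₚ.pos-+ (N * L) N))

    level<1+N : ∀ j → j ≤ length p → ℤ.∣ level (suc j) ∣ < suc N
    level<1+N j j≤ = s≤s (ℤₚ.drop‿+≤+
      (subst (ℤ._≤ + N) (sym (ℤₚ.0≤i⇒+∣i∣≡i (proj₁ (level-bounds j j≤)))) (proj₂ (level-bounds j j≤))))

    labelOf : Fin (nBoxes p) → Fin (suc N)
    labelOf i = fromℕ< (level<1+N (toℕ i) (ℕₚ.≤-pred (Finₚ.toℕ<n i)))

    label : Label
    label = Vec.tabulate labelOf

    profile-label : ∀ k → k ≤ dOf p → + profile label k ≡ level k
    profile-label zero    _  = cong (λ c → + 0 ℤ.- + c) (sym (ℕₚ.*-zeroʳ N))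
    profile-label (suc j) j< = trans (cong +_ value) (ℤₚ.0≤i⇒+∣i∣≡i (proj₁ (level-bounds j j≤)))
      where
      j≤ : j ≤ length p
      j≤ = ℕₚ.≤-pred (subst (suc j ≤_) (dOf≡nBoxes p) j<)
      i = fromℕ< (s≤s j≤)
      value : profile label (suc j) ≡ ℤ.∣ level (suc j) ∣
      value = begin
        valueAt label j                    ≡⟨ cong (valueAt label) (sym (Finₚ.toℕ-fromℕ< (s≤s j≤))) ⟩
        valueAt label (toℕ i)              ≡⟨ valueAt-lookup label i ⟩
        toℕ (lookup label i)               ≡⟨ cong toℕ (Vecₚ.lookup∘tabulate labelOf i) ⟩
        toℕ (labelOf i)                    ≡⟨ Finₚ.toℕ-fromℕ< (level<1+N (toℕ i) (ℕₚ.≤-pred (Finₚ.toℕ<n i))) ⟩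
        ℤ.∣ level (suc (toℕ i)) ∣          ≡⟨ cong (λ k → ℤ.∣ level (suc k) ∣) (Finₚ.toℕ-fromℕ< (s≤s j≤)) ⟩
        ℤ.∣ level (suc j) ∣                ∎
        where open ≡-Reasoning

    gridEntry-label : ∀ k (k< : k < dOf p) → gridEntry label k ≡ lookup z (fromℕ< k<)
    gridEntry-label k k< = begin
      + profile label (suc k) ℤ.- + profile label k ℤ.+ + (N * δ k)
        ≡⟨ cong₂ (λ a b → a ℤ.- b ℤ.+ + (N * δ k)) (profile-label (suc k) k<) (profile-label k (ℕₚ.<⇒≤ k<)) ⟩
      (S (suc k) ℤ.- + (N * lower (suc k))) ℤ.- (S k ℤ.- + (N * lower k)) ℤ.+ + (N * δ k)
        ≡⟨ cong₂ (λ a b → (a ℤ.- b) ℤ.- (S k ℤ.- + (N * lower k)) ℤ.+ + (N * δ k)) (prefixSumℤ-suc z k k<) lower-suc ⟩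
      (S k ℤ.+ zₖ ℤ.- (+ (N * lower k) ℤ.+ + (N * δ k))) ℤ.- (S k ℤ.- + (N * lower k)) ℤ.+ + (N * δ k)
        ≡⟨ solve 4 (λ s z a b → (s :+ z :- (a :+ b)) :- (s :- a) :+ b := z) refl (S k) zₖ (+ (N * lower k)) (+ (N * δ k)) ⟩
      zₖ ∎
      where
      open ≡-Reasoning
      open ℤ-Solver
      zₖ = lookup z (fromℕ< k<)
      lower-suc : + (N * lower (suc k)) ≡ + (N * lower k) ℤ.+ + (N * δ k)
      lower-suc = trans (cong (λ v → + (N * v)) (height-suc (lowerPath p) k
                          (subst (k <_) (sym (length-lowerPath p)) (ℕₚ.<-trans k< (ℕₚ.n<1+n _)))))
                  (trans (cong +_ (ℕₚ.*-distribˡ-+ N (lower k) (δ k))) (ℤₚ.pos-+ (N * lower k) (N * δ k)))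

    gridVector-label : gridVector label ≡ z
    gridVector-label = ≡-lookup λ i → trans (Vecₚ.lookup∘tabulate (gridEntry label ∘ toℕ) i)
      (trans (gridEntry-label (toℕ i) (Finₚ.toℕ<n i)) (cong (lookup z) (Finₚ.fromℕ<-toℕ i (Finₚ.toℕ<n i))))

    profile-label-step : ∀ k (k< : k < dOf p) → + profile label (suc k) ≡ + profile label k ℤ.+ (lookup z (fromℕ< k<) ℤ.- + (N * δ k))
    profile-label-step k k< = trans
      (solve 3 (λ a b c → a := b :+ ((a :- b :+ c) :- c)) refl (+ profile label (suc k)) (+ profile label k) (+ (N * δ k)))
      (cong (λ v → + profile label k ℤ.+ (v ℤ.- + (N * δ k))) (gridEntry-label k k<))
      where open ℤ-Solver

    label-monotone : T (isMonotone (coverGraph p) label)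
    label-monotone = ⇒isMonotone λ i j e → monotone-on-edge i j (coverGraph⇒ e)
      where
      k<d : ∀ (i : Fin (nBoxes p)) → toℕ i < dOf p
      k<d i = subst (toℕ i <_) (sym (dOf≡nBoxes p)) (Finₚ.toℕ<n i)
      δ-step : ∀ a → a < length p → δ (suc a) ≡ boolToℕ (isU (stepAt p a))
      δ-step a a< = cong boolToℕ (bitAt-lowerPath p a a<)
      monotone-on-edge : ∀ i j → CoverEdge p i j → toℕ (lookup label i) ≤ toℕ (lookup label j)
      monotone-on-edge i j (inj₁ (j≡ , sR)) = subst₂ _≤_
        (trans (cong (profile label) j≡) (valueAt-lookup label i)) (valueAt-lookup label j)
        (step-rises _ _ (lookup z (fromℕ< (k<d j))) (N * δ (toℕ j)) no-drop (profile-label-step (toℕ j) (k<d j))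
                    (proj₁ (z-bounds (fromℕ< (k<d j)))))
        where
        no-drop : N * δ (toℕ j) ≡ 0
        no-drop = trans (cong (λ v → N * v) (trans (cong δ j≡)
          (trans (δ-step (toℕ i) (step-bound p i j j≡)) (cong (boolToℕ ∘ isU) sR)))) (ℕₚ.*-zeroʳ N)
      monotone-on-edge i j (inj₂ (i≡ , sU)) = subst₂ _≤_
        (valueAt-lookup label i) (trans (cong (profile label) i≡) (valueAt-lookup label j))
        (step-falls _ _ (lookup z (fromℕ< (k<d i))) (N * δ (toℕ i)) N full-drop (profile-label-step (toℕ i) (k<d i))
                    (proj₂ (z-bounds (fromℕ< (k<d i)))))
        where
        full-drop : N * δ (toℕ i) ≡ N
        full-drop = trans (cong (λ v → N * v) (trans (cong δ i≡)
          (trans (δ-step (toℕ j) (step-bound p j i i≡)) (cong (boolToℕ ∘ isU) sU)))) (ℕₚ.*-identityʳ N)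

gridPoints-count : ∀ p t → IsCount (GridPoint p t) (#orderMaps (coverGraph p) (suc (suc t)))
gridPoints-count p t = isCount-image (isMonotone (coverGraph p)) gridVector (GridPoint p t)
  (proj₂ (orderMaps-finite (coverGraph p) (suc (suc t))))
  (λ y y′ _ _ → gridVector-injective y y′)
  (λ { z (x , (comb , (valid , total) , coords) , projection) → let open FromGridPoint z x comb valid total coords projection
         in label , label-monotone , gridVector-label })
  (λ y mono → Mixture.gridVector-gridPoint y (monotone⇒followsPath y mono))
  where
  open GridMap p t
  open GridInverse p t

-- Asymptotics

_↓_ : ℕ → ℕ → ℕ
M     ↓ zero  = 1
zero  ↓ suc D = 0
suc M ↓ suc D = suc M * (M ↓ D)

↓-zero : ∀ M D → M < D → M ↓ D ≡ 0
↓-zero zero    (suc D) _        = refl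
↓-zero (suc M) (suc D) (s≤s M<D) = trans (cong (suc M *_) (↓-zero M D M<D)) (ℕₚ.*-zeroʳ (suc M))

↓-suc : ∀ M D → M ↓ suc D ≡ (M ∸ D) * (M ↓ D)
↓-suc zero    D       = sym (cong (_* (zero ↓ D)) (ℕₚ.0∸n≡0 D))
↓-suc (suc M) zero    = refl
↓-suc (suc M) (suc D) = trans (cong (suc M *_) (↓-suc M D))
  (solve 3 (λ m a b → m :* (a :* b) := a :* (m :* b)) refl (suc M) (M ∸ D) (M ↓ D))
  where open ℕ-Solver

!*C≡↓ : ∀ M D → D ! * (M C D) ≡ M ↓ D
!*C≡↓ M       zero    = refl
!*C≡↓ zero    (suc D) = trans (cong (suc D ! *_) (k>n⇒nCk≡0 {0} {suc D} (s≤s z≤n))) (ℕₚ.*-zeroʳ (suc D !))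
!*C≡↓ (suc M) (suc D) = begin
  suc D ! * (suc M C suc D)                   ≡⟨ cong (suc D ! *_) (sym (nCk+nC[k+1]≡[n+1]C[k+1] M D)) ⟩
  suc D ! * (M C D + M C suc D)               ≡⟨ ℕₚ.*-distribˡ-+ (suc D !) (M C D) _ ⟩
  suc D ! * (M C D) + suc D ! * (M C suc D)   ≡⟨ cong₂ _+_ (trans (ℕₚ.*-assoc (suc D) (D !) _) (cong (suc D *_) (!*C≡↓ M D)))
                                                           (!*C≡↓ M (suc D)) ⟩
  suc D * (M ↓ D) + M ↓ suc D                 ≡⟨ cong (λ v → suc D * (M ↓ D) + v) (↓-suc M D) ⟩
  suc D * (M ↓ D) + (M ∸ D) * (M ↓ D)         ≡⟨ sym (ℕₚ.*-distribʳ-+ (M ↓ D) (suc D) (M ∸ D)) ⟩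
  (suc D + (M ∸ D)) * (M ↓ D)                 ≡⟨ factor ⟩
  suc M * (M ↓ D)                             ∎
  where
  open ≡-Reasoning
  factor : (suc D + (M ∸ D)) * (M ↓ D) ≡ suc M * (M ↓ D)
  factor with D ℕₚ.≤? M
  ... | yes D≤M = cong (λ v → suc v * (M ↓ D)) (ℕₚ.m+[n∸m]≡n D≤M)
  ... | no  D≰M rewrite ↓-zero M D (ℕₚ.≰⇒> D≰M) = trans (ℕₚ.*-zeroʳ (suc D + (M ∸ D))) (sym (ℕₚ.*-zeroʳ (suc M)))

↓≤^ : ∀ M D → M ↓ D ≤ M ^ D
↓≤^ M       zero    = ℕₚ.≤-refl
↓≤^ zero    (suc D) = z≤n
↓≤^ (suc M) (suc D) = ℕₚ.*-monoʳ-≤ (suc M) (ℕₚ.≤-trans (↓≤^ M D) (ℕₚ.^-monoˡ-≤ D (ℕₚ.n≤1+n M)))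

^≤↓ : ∀ b D → suc b ^ D ≤ (b + D) ↓ D
^≤↓ b zero    = ℕₚ.≤-refl
^≤↓ b (suc D) = subst (λ v → suc b ^ suc D ≤ v ↓ suc D) (sym (ℕₚ.+-suc b D))
  (ℕₚ.*-mono-≤ (s≤s (ℕₚ.m≤m+n b D)) (^≤↓ b D))

+-^-suc-≤ : ∀ b c L → (b + c) ^ suc L ≤ b ^ suc L + suc L * c * (b + c) ^ L
+-^-suc-≤ b c zero    = ℕₚ.≤-reflexive (solve 2 (λ b c → (b :+ c) :* con 1 := b :* con 1 :+ (con 1 :* c) :* con 1) refl b c)
  where open ℕ-Solver
+-^-suc-≤ b c (suc L) = begin
  (b + c) * (b + c) ^ suc L
    ≤⟨ ℕₚ.*-monoʳ-≤ (b + c) (+-^-suc-≤ b c L) ⟩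
  (b + c) * (b ^ suc L + suc L * c * (b + c) ^ L)
    ≡⟨ solve 5 (λ b c X L Y → (b :+ c) :* (X :+ L :* c :* Y) := b :* X :+ c :* X :+ L :* c :* ((b :+ c) :* Y))
               refl b c (b ^ suc L) (suc L) ((b + c) ^ L) ⟩
  b * b ^ suc L + c * b ^ suc L + suc L * c * ((b + c) * (b + c) ^ L)
    ≤⟨ ℕₚ.+-monoˡ-≤ _ (ℕₚ.+-monoʳ-≤ (b * b ^ suc L) (ℕₚ.*-monoʳ-≤ c (ℕₚ.^-monoˡ-≤ (suc L) (ℕₚ.m≤m+n b c)))) ⟩
  b * b ^ suc L + c * (b + c) ^ suc L + suc L * c * (b + c) ^ suc L
    ≡⟨ solve 4 (λ X c Y L → X :+ c :* Y :+ L :* c :* Y := X :+ (con 1 :+ L) :* c :* Y)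
               refl (b * b ^ suc L) c ((b + c) ^ suc L) (suc L) ⟩
  b ^ suc (suc L) + suc (suc L) * c * (b + c) ^ suc L ∎
  where
  open ℕₚ.≤-Reasoning
  open ℕ-Solver

2+n^≤ : ∀ n L → suc (suc n) ^ L ≤ 2 ^ L * suc n ^ L
2+n^≤ n zero    = ℕₚ.≤-refl
2+n^≤ n (suc L) = begin
  suc (suc n) * suc (suc n) ^ L       ≤⟨ ℕₚ.*-mono-≤ 2+n≤2[1+n] (2+n^≤ n L) ⟩
  (2 * suc n) * (2 ^ L * suc n ^ L)   ≡⟨ solve 3 (λ n a b → (con 2 :* n) :* (a :* b) := (con 2 :* a) :* (n :* b))
                                               refl (suc n) (2 ^ L) (suc n ^ L) ⟩
  (2 * 2 ^ L) * (suc n * suc n ^ L)   ∎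
  where
  open ℕₚ.≤-Reasoning
  open ℕ-Solver
  2+n≤2[1+n] : suc (suc n) ≤ 2 * suc n
  2+n≤2[1+n] = subst (suc (suc n) ≤_) (solve 1 (λ n → con 2 :+ (n :+ n) := con 2 :* (con 1 :+ n)) refl n)
                     (s≤s (s≤s (ℕₚ.m≤m+n n n)))

module _ (L N : ℕ) (D≤N : suc L ≤ N) where

  private
    D = suc L

  N^≤↓ : N ^ D ≤ suc N ↓ D + D * D * N ^ L
  N^≤↓ = begin
    N ^ D                               ≡⟨ cong (_^ D) (sym N≡) ⟩
    (b + D) ^ D                         ≤⟨ +-^-suc-≤ b D L ⟩
    b ^ D + D * D * (b + D) ^ L         ≤⟨ ℕₚ.+-mono-≤ (ℕₚ.≤-trans (ℕₚ.^-monoˡ-≤ D (ℕₚ.≤-trans (ℕₚ.n≤1+n b) (ℕₚ.n≤1+n (suc b))))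
                                                                   (^≤↓ (suc b) D))
                                                      (ℕₚ.≤-reflexive (cong (λ v → D * D * v ^ L) N≡)) ⟩
    (suc b + D) ↓ D + D * D * N ^ L     ≡⟨ cong (λ v → suc v ↓ D + D * D * N ^ L) N≡ ⟩
    suc N ↓ D + D * D * N ^ L           ∎
    where
    open ℕₚ.≤-Reasoning
    b = N ∸ D
    N≡ : b + D ≡ N
    N≡ = ℕₚ.m∸n+n≡m D≤N

  ↓≤N^ : suc N ↓ D ≤ N ^ D + D * suc N ^ L
  ↓≤N^ = begin
    suc N ↓ D                 ≤⟨ ↓≤^ (suc N) D ⟩
    suc N ^ D                 ≡⟨ cong (_^ D) (ℕₚ.+-comm 1 N) ⟩
    (N + 1) ^ D               ≤⟨ +-^-suc-≤ N 1 L ⟩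
    N ^ D + D * 1 * (N + 1) ^ L ≡⟨ cong₂ (λ u v → N ^ D + u * v ^ L) (ℕₚ.*-identityʳ D) (ℕₚ.+-comm N 1) ⟩
    N ^ D + D * suc N ^ L     ∎
    where open ℕₚ.≤-Reasoning

errorConstant : ℕ → ℕ → ℕ
errorConstant L f = (f * suc L * suc L + f * suc L + suc L ! * (suc L * suc L)) * 2 ^ L

-- Within the bounds of orderMaps-lower and orderMaps-upper, D! a differs from f N^D by O(N^(D-1)).
module _ (L f a t : ℕ) (D≤N : suc L ≤ suc t)
         (a≥ : f * (suc (suc t) C suc L) ≤ a) (a≤ : a ≤ f * (suc (suc t) C suc L) + suc L * (suc L * suc (suc t) ^ L)) where

  open ℕ-Solver

  private
    D N M₁ : ℕ
    D = suc L
    N = suc t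
    M₁ = suc N
    K₀ : ℕ
    K₀ = f * D * D + f * D + D ! * (D * D)

    error≤ : K₀ * M₁ ^ L ≤ errorConstant L f * N ^ L
    error≤ = ℕₚ.≤-trans (ℕₚ.*-monoʳ-≤ K₀ (2+n^≤ t L)) (ℕₚ.≤-reflexive (sym (ℕₚ.*-assoc K₀ (2 ^ L) (N ^ L))))

    D!C≡ : D ! * (f * (M₁ C D)) ≡ f * (M₁ ↓ D)
    D!C≡ = trans (solve 3 (λ d f c → d :* (f :* c) := f :* (d :* c)) refl (D !) f (M₁ C D)) (cong (f *_) (!*C≡↓ M₁ D))

    D!a≥ : f * (M₁ ↓ D) ≤ D ! * a
    D!a≥ = subst (_≤ D ! * a) D!C≡ (ℕₚ.*-monoʳ-≤ (D !) a≥)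

    D!a≤ : D ! * a ≤ f * (M₁ ↓ D) + D ! * (D * (D * M₁ ^ L))
    D!a≤ = ℕₚ.≤-trans (ℕₚ.*-monoʳ-≤ (D !) a≤)
      (ℕₚ.≤-reflexive (trans (ℕₚ.*-distribˡ-+ (D !) _ _) (cong (_+ D ! * (D * (D * M₁ ^ L))) D!C≡)))

  scaled-lower : f * N ^ D ≤ D ! * a + errorConstant L f * N ^ L
  scaled-lower = begin
    f * N ^ D
      ≤⟨ ℕₚ.*-monoʳ-≤ f (N^≤↓ L N D≤N) ⟩
    f * (M₁ ↓ D + D * D * N ^ L)
      ≡⟨ ℕₚ.*-distribˡ-+ f (M₁ ↓ D) _ ⟩
    f * (M₁ ↓ D) + f * (D * D * N ^ L)
      ≤⟨ ℕₚ.+-mono-≤ D!a≥ (ℕₚ.≤-trans (ℕₚ.≤-reflexive (solve 3 (λ f d n → f :* (d :* d :* n) := f :* d :* d :* n) refl f D (N ^ L)))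
                                      (ℕₚ.*-monoʳ-≤ (f * D * D) (ℕₚ.^-monoˡ-≤ L (ℕₚ.n≤1+n N)))) ⟩
    D ! * a + f * D * D * M₁ ^ L
      ≤⟨ ℕₚ.+-monoʳ-≤ (D ! * a) (ℕₚ.*-monoˡ-≤ (M₁ ^ L) (ℕₚ.≤-trans (ℕₚ.m≤m+n (f * D * D) (f * D)) (ℕₚ.m≤m+n _ _))) ⟩
    D ! * a + K₀ * M₁ ^ L
      ≤⟨ ℕₚ.+-monoʳ-≤ (D ! * a) error≤ ⟩
    D ! * a + errorConstant L f * N ^ L ∎
    where open ℕₚ.≤-Reasoning

  scaled-upper : D ! * a ≤ f * N ^ D + errorConstant L f * N ^ L
  scaled-upper = begin
    D ! * a
      ≤⟨ D!a≤ ⟩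
    f * (M₁ ↓ D) + D ! * (D * (D * M₁ ^ L))
      ≤⟨ ℕₚ.+-monoˡ-≤ _ (ℕₚ.*-monoʳ-≤ f (↓≤N^ L N D≤N)) ⟩
    f * (N ^ D + D * M₁ ^ L) + D ! * (D * (D * M₁ ^ L))
      ≡⟨ solve 5 (λ f P d g m → f :* (P :+ d :* m) :+ g :* (d :* (d :* m)) := f :* P :+ (f :* d :+ g :* (d :* d)) :* m)
                 refl f (N ^ D) D (D !) (M₁ ^ L) ⟩
    f * N ^ D + (f * D + D ! * (D * D)) * M₁ ^ L
      ≤⟨ ℕₚ.+-monoʳ-≤ (f * N ^ D) (ℕₚ.*-monoˡ-≤ (M₁ ^ L)
           (ℕₚ.≤-trans (ℕₚ.m≤n+m _ (f * D * D)) (ℕₚ.≤-reflexive (sym (ℕₚ.+-assoc (f * D * D) (f * D) _))))) ⟩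
    f * N ^ D + K₀ * M₁ ^ L
      ≤⟨ ℕₚ.+-monoʳ-≤ (f * N ^ D) error≤ ⟩
    f * N ^ D + errorConstant L f * N ^ L ∎
    where open ℕₚ.≤-Reasoning

∣-∣≤ : ∀ X Y B → X ≤ Y + B → Y ≤ X + B → ℤ.∣ + X ℤ.- + Y ∣ ≤ B
∣-∣≤ X Y B X≤ Y≤ with Y ℕₚ.≤? X
... | yes Y≤X = subst (_≤ B) (sym (trans (cong ℤ.∣_∣ (ℤₚ.m-n≡m⊖n X Y)) (cong ℤ.∣_∣ (ℤₚ.⊖-≥ Y≤X)))) (ℕₚ.m≤n+o⇒m∸n≤o X Y X≤)
... | no  Y≰X = subst (_≤ B) (sym (trans (cong ℤ.∣_∣ (ℤₚ.m-n≡m⊖n X Y))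
                  (trans (cong ℤ.∣_∣ (ℤₚ.⊖-< (ℕₚ.≰⇒> Y≰X))) (ℤₚ.∣-i∣≡∣i∣ (+ (Y ∸ X)))))) (ℕₚ.m≤n+o⇒m∸n≤o Y X Y≤)

positive-fraction : ∀ ε → 0ℚ ℚ.< ε → ∃₂ λ n q → ε ≡ + suc n / suc q
positive-fraction ε 0<ε = go ε (ℚ.positive 0<ε)
  where
  go : ∀ ε → ℚ.Positive ε → ∃₂ λ n q → ε ≡ + suc n / suc q
  go ε@(mkℚ +[1+ n ] q _) _ = n , q , sym (ℚₚ.↥p/↧p≡p ε)
  go (mkℚ (+ zero) q _) ()
  go (mkℚ -[1+ n ] q _) ()

/-distance : ∀ X f P′ → ℚ.∣ (+ X) / suc P′ ℚ.- + f / 1 ∣ ≡ (+ ℤ.∣ + X ℤ.- + (f * suc P′) ∣) / suc P′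
/-distance X f P′ = begin
  ℚ.∣ (+ X) / suc P′ ℚ.- + f / 1 ∣                    ≡⟨ cong (λ v → ℚ.∣ (+ X) / suc P′ ℚ.+ v ∣) (-‿/ (+ f) 0) ⟩
  ℚ.∣ (+ X) / suc P′ ℚ.+ (ℤ.- + f) / 1 ∣              ≡⟨ cong ℚ.∣_∣ (/-+ (+ X) (ℤ.- + f) P′ 0) ⟩
  ℚ.∣ Δ / suc (P′ * 1) ∣                              ≡⟨ ∣/∣ Δ (P′ * 1) ⟩
  (+ ℤ.∣ Δ ∣) / suc (P′ * 1)                          ≡⟨ cong₂ (λ u v → (+ ℤ.∣ u ∣) / suc v) Δ≡ (ℕₚ.*-identityʳ P′) ⟩
  (+ ℤ.∣ + X ℤ.- + (f * suc P′) ∣) / suc P′           ∎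
  where
  open ≡-Reasoning
  Δ = + X ℤ.* + 1 ℤ.+ (ℤ.- + f) ℤ.* + suc P′
  Δ≡ : Δ ≡ + X ℤ.- + (f * suc P′)
  Δ≡ = trans (solve 3 (λ x f p → x :* con (+ 1) :+ (:- f) :* p := x :- f :* p) refl (+ X) (+ f) (+ suc P′))
             (cong (λ v → + X ℤ.- v) (sym (ℤₚ.pos-* f (suc P′))))
    where open ℤ-Solver

/-cong-denominator : ∀ {P Q} (P≡Q : P ≡ Q) (a : ℤ) .{{_ : NonZero P}} .{{_ : NonZero Q}} → a / P ≡ a / Q
/-cong-denominator refl a = refl

ratio-limit : ∀ e L → e ≡ suc L → ∀ f K T₀ (a : ℕ → ℕ) →
  (∀ t → T₀ ≤ t → (f * suc t ^ e ≤ e ! * a t + K * suc t ^ L) × (e ! * a t ≤ f * suc t ^ e + K * suc t ^ L)) →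
  ∀ ε → 0ℚ ℚ.< ε → ∃ λ T → ∀ t → T ≤ t →
    ℚ.∣ _/_ (+ (e ! * a t)) (suc t ^ e) {{ℕₚ.m^n≢0 (suc t) e}} ℚ.- (+ f / 1) ∣ ℚ.< ε
ratio-limit e L refl f K T₀ a bounds ε 0<ε with positive-fraction ε 0<ε
... | n , q , refl = T₀ + K * suc q , close
  where
  close : ∀ t → T₀ + K * suc q ≤ t →
          ℚ.∣ _/_ (+ (e ! * a t)) (suc t ^ e) {{ℕₚ.m^n≢0 (suc t) e}} ℚ.- (+ f / 1) ∣ ℚ.< + suc n / suc q
  close t T≤t = subst (ℚ._< + suc n / suc q) (sym distance)
    (/-mono-< (+ ℤ.∣ Δ ∣) (+ suc n) P′ q (subst₂ ℤ._<_ (ℤₚ.pos-* ℤ.∣ Δ ∣ (suc q)) (ℤₚ.pos-* (suc n) (suc P′)) (ℤ.+<+ Δq<)))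
    where
    N = suc t
    P = N ^ e
    P′ = pred P
    P≡ : suc P′ ≡ P
    P≡ = ℕₚ.suc-pred P {{ℕₚ.m^n≢0 N e}}
    X = e ! * a t
    Δ = + X ℤ.- + (f * suc P′)
    distance : ℚ.∣ _/_ (+ X) P {{ℕₚ.m^n≢0 N e}} ℚ.- (+ f / 1) ∣ ≡ (+ ℤ.∣ Δ ∣) / suc P′
    distance = trans (cong (λ v → ℚ.∣ v ℚ.- + f / 1 ∣) (/-cong-denominator (sym P≡) (+ X) {{ℕₚ.m^n≢0 N e}})) (/-distance X f P′)
    Δ≤ : ℤ.∣ Δ ∣ ≤ K * N ^ L
    Δ≤ = subst (λ v → ℤ.∣ + X ℤ.- + (f * v) ∣ ≤ K * N ^ L) (sym P≡) (∣-∣≤ X (f * P) (K * N ^ L) (proj₂ bds) (proj₁ bds))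
      where bds = bounds t (ℕₚ.≤-trans (ℕₚ.m≤m+n T₀ _) T≤t)
    Kq<N : K * suc q < N
    Kq<N = s≤s (ℕₚ.≤-trans (ℕₚ.m≤n+m (K * suc q) T₀) T≤t)
    Δq< : ℤ.∣ Δ ∣ * suc q < suc n * suc P′
    Δq< = begin-strict
      ℤ.∣ Δ ∣ * suc q       ≤⟨ ℕₚ.*-monoˡ-≤ (suc q) Δ≤ ⟩
      K * N ^ L * suc q     ≡⟨ solve 3 (λ k n q → k :* n :* q := k :* q :* n) refl K (N ^ L) (suc q) ⟩
      K * suc q * N ^ L     <⟨ ℕₚ.*-monoˡ-< (N ^ L) {{ℕₚ.m^n≢0 N L}} Kq<N ⟩
      N * N ^ L             ≤⟨ ℕₚ.m≤n*m (N * N ^ L) (suc n) ⟩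
      suc n * (N * N ^ L)   ≡⟨ cong (suc n *_) (sym P≡) ⟩
      suc n * suc P′        ∎
      where
      open ℕₚ.≤-Reasoning
      open ℕ-Solver

mainTheorem9 : (p : BorderStrip) →
    ∃ λ f → IsCount (IsSYT p) f × NormalizedVolume p (+ f / 1)
mainTheorem9 p = f , syt-count p , volume
  where
  G = coverGraph p
  f = extensions (nBoxes p) G
  L = length p
  K = errorConstant L f
  a : ℕ → ℕ
  a t = #orderMaps G (suc (suc t))
  scaled-bounds : ∀ t → L ≤ t →
    (f * suc t ^ dOf p ≤ dOf p ! * a t + K * suc t ^ L) × (dOf p ! * a t ≤ f * suc t ^ dOf p + K * suc t ^ L)
  scaled-bounds t L≤t = subst (λ e → (f * suc t ^ e ≤ e ! * a t + K * suc t ^ L) × (e ! * a t ≤ f * suc t ^ e + K * suc t ^ L))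
    (sym (dOf≡nBoxes p)) (scaled-lower L f (a t) t (s≤s L≤t) lower upper , scaled-upper L f (a t) t (s≤s L≤t) lower upper)
    where
    lower = orderMaps-lower G (suc (suc t))
    upper = orderMaps-upper G (suc (suc t)) (coverGraph-irreflexive p)
  volume : NormalizedVolume p (+ f / 1)
  volume ε 0<ε = proj₁ limit , λ t T≤t → a t , gridPoints-count p t , proj₂ limit t T≤t
    where limit = ratio-limit (dOf p) L (dOf≡nBoxes p) f K L a scaled-bounds ε 0<ε
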